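{- For every $k\ge3$, $$I^{12\cdots k}(x,q)=A^{12\cdots k}(x,q)-\sum_{m=1}^{k-2}\left(I^{12\cdots(m+1)}(x,q)-I^{12\cdots m}(x,q)\right)\left(A^{12\cdots(k-m)}(x,q)-1\right)-1.$$
   Context: For a permutation $\pi=\pi_1\cdots\pi_n$ of $[n]$, let $i_\pi$ be the smallest index $i$ with $\{\pi_1,\dots,\pi_i\}=\{1,\dots,i\}$; $\pi$ is indecomposable if $i_\pi=n$ (the empty permutation is not indecomposable). A permutation avoids $12\cdots j$ if it has no increasing subsequence of length $j$. A descent of $\pi$ is an index $i$ with $\pi_i>\pi_{i+1}$. For a pattern $\sigma$, $A^\sigma_{n,i}$ (resp. $I^\sigma_{n,i}$) is the number of $\sigma$-avoiding permutations (resp. $\sigma$-avoiding indecomposable permutations) of $[n]$ with $i$ descents; $A^\sigma(x,q)=1+\sum_{n\ge1}\sum_iA^\sigma_{n,i}x^nq^i$ and $I^\sigma(x,q)=\sum_{n\ge1}\sum_iI^\sigma_{n,i}x^nq^i$. In particular $I^{1}(x,q)=0$. -}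

module Defs where

open import Data.Bool using (Bool; true; false; _∧_; _∨_; not; if_then_else_)
open import Data.Nat using (ℕ; zero; suc; _∸_; _<ᵇ_; _≡ᵇ_)
open import Data.List using (List; []; _∷_; map; _++_; length; filter; upTo; take; concatMap; foldr)
open import Data.Bool.ListAction using (any; all)
open import Data.Integer using (ℤ; +_; _-_; _*_; _+_)

-- Permutations of [n], encoded 0-based: a list w of length n whose
-- entries lie in {0,…,n-1} and are pairwise distinct (so w is a
-- permutation of {0,…,n-1}; value v stands for v+1 in the paper).

_∈ᵇ_ : ℕ → List ℕ → Bool
v ∈ᵇ [] = false
v ∈ᵇ (x ∷ xs) = (v ≡ᵇ x) ∨ (v ∈ᵇ xs)

distinct : List ℕ → Bool
distinct [] = true
distinct (x ∷ xs) = not (x ∈ᵇ xs) ∧ distinct xs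

words : ℕ → ℕ → List (List ℕ)
words n zero = [] ∷ []
words n (suc m) = concatMap (λ v → map (v ∷_) (words n m)) (upTo n)

perms : ℕ → List (List ℕ)
perms n = filter (λ w → Data.Bool.T? (distinct w)) (words n n)
  where import Data.Bool

des : List ℕ → ℕ
des [] = 0
des (x ∷ []) = 0
des (x ∷ y ∷ xs) = (if y <ᵇ x then 1 else 0) Data.Nat.+ des (y ∷ xs)

-- Pattern avoidance of 12⋯j: no increasing subsequence of length j.

subseqs : List ℕ → List (List ℕ)
subseqs [] = [] ∷ []
subseqs (x ∷ xs) = map (x ∷_) (subseqs xs) ++ subseqs xs

increasing : List ℕ → Bool
increasing [] = true
increasing (x ∷ []) = true
increasing (x ∷ y ∷ xs) = (x <ᵇ y) ∧ increasing (y ∷ xs)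

avoids : ℕ → List ℕ → Bool
avoids j w = not (any (λ s → (length s ≡ᵇ j) ∧ increasing s) (subseqs w))

-- Indecomposability.  The prefix of length i is {1,…,i} (0-based:
-- {0,…,i-1}) iff every element of {0,…,i-1} occurs in it and every
-- element of it is < i.

prefixIsInitial : List ℕ → ℕ → Bool
prefixIsInitial w i = all (λ v → v ∈ᵇ take i w) (upTo i) ∧ all (λ v → v <ᵇ i) (take i w)

-- smallest i in {1,…,n} with the property (search from 1 upward; returns
-- n when none smaller is found; n always has the property for a
-- permutation of [n])
firstFrom : List ℕ → ℕ → ℕ → ℕ
firstFrom w i zero = i
firstFrom w i (suc fuel) = if prefixIsInitial w i then i else firstFrom w (suc i) fuel

iπ : List ℕ → ℕ
iπ w = firstFrom w 1 (length w ∸ 1)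

indecomposable : List ℕ → Bool
indecomposable [] = false
indecomposable w@(_ ∷ _) = iπ w ≡ᵇ length w

count : (List ℕ → Bool) → List (List ℕ) → ℕ
count p ws = length (filter (λ w → Data.Bool.T? (p w)) ws)
  where import Data.Bool

Acount : ℕ → ℕ → ℕ → ℕ
Acount j n i = count (λ w → avoids j w ∧ (des w ≡ᵇ i)) (perms n)

Icount : ℕ → ℕ → ℕ → ℕ
Icount j n i = count (λ w → avoids j w ∧ indecomposable w ∧ (des w ≡ᵇ i)) (perms n)

-- Formal power series in x, q with integer coefficients:
-- f n i is the coefficient of x^n q^i.

Series : Set
Series = ℕ → ℕ → ℤ

one : Series
one zero zero = + 1
one _ _ = + 0

_⊖_ : Series → Series → Series
(f ⊖ g) n i = f n i - g n i

_⊕_ : Series → Series → Series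
(f ⊕ g) n i = f n i + g n i

zeroS : Series
zeroS _ _ = + 0

sumTo : ℕ → (ℕ → ℤ) → ℤ
sumTo n h = foldr (λ a acc → h a + acc) (+ 0) (upTo (suc n))

_⊗_ : Series → Series → Series
(f ⊗ g) n i = sumTo n (λ a → sumTo i (λ b → f a b * g (n ∸ a) (i ∸ b)))

sumS : ℕ → (ℕ → Series) → Series
sumS zero F = zeroS
sumS (suc M) F = sumS M F ⊕ F (suc M)

A : ℕ → Series
A j zero i = one zero i
A j (suc n) i = + Acount j (suc n) i

I : ℕ → Series
I j zero i = + 0
I j (suc n) i = + Icount j (suc n) i

-- Classify a permutation π of [n] (n ≥ 1) by the length a of its
-- first block, i.e. a = i_π ∈ {1,…,n}.  If a = n, π is indecomposable.  If
-- a < n, π is the direct sum x ⊕ y of an indecomposable permutation x of [a]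
-- and an arbitrary permutation y of [n−a], and this decomposition is a
-- bijection.  Under it descents add up, des(x ⊕ y) = des x + des y, and so do
-- longest increasing subsequences; hence x ⊕ y avoids 12⋯k iff lis(x) = m for
-- some 1 ≤ m ≤ k−2 and y avoids 12⋯(k−m).  The indecomposable permutations
-- with lis exactly m are counted by I^{12⋯(m+1)} − I^{12⋯m}.  Summing over a and
-- the split of the descents gives, coefficientwise, the natural-number identity
--   A_{n,i} = I_{n,i} + Σ_m Σ_a Σ_c J^m_{a,c} · (A^{k−m} − 1)_{n−a,i−c}
-- (Acount-recurrence), and the corollary is its translation into integer series.
module Submission where

open import Defs
open import Data.Nat using (ℕ; zero; suc; _+_; _*_; _∸_; _≤_; _<_; _<ᵇ_; _≡ᵇ_; z≤n; s≤s)
open import Data.Nat.Properties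
open import Data.Nat.Tactic.RingSolver using (solve-∀)
open import Data.Bool using (Bool; true; false; T; T?; _∧_; _∨_; not; if_then_else_)
open import Data.Bool.Properties using (T-∧; T-∨; T-≡; ∧-zeroʳ)
open import Data.Bool.ListAction using (any; all)
open import Data.List using (List; []; _∷_; _++_; map; length; filter; upTo; take; concatMap; applyUpTo; foldr)
open import Data.List.Properties using (take-all; length-++; length-++-≤ˡ; length-map; upTo-∷ʳ)
open import Data.List.Relation.Binary.Sublist.Propositional {A = ℕ} using (_⊆_; []; _∷_; _∷ʳ_; minimum)
open import Data.List.Relation.Binary.Sublist.Propositional.Properties using (map⁺)
open import Data.List.Relation.Binary.Sublist.Heterogeneous.Properties using (∷ˡ⁻; length-mono-≤; ++⁺)
open import Data.List.Relation.Unary.Any using (here)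
open import Data.List.Relation.Unary.Any.Properties using (any⁺; any⁻)
open import Data.List.Membership.Propositional using (_∈_; find; lose)
import Data.List.Membership.Propositional.Properties as ∈ₚ
open import Data.Product using (Σ; _×_; _,_; proj₁; proj₂)
open import Data.Sum using (_⊎_; inj₁; inj₂; map₁)
open import Data.Empty using (⊥; ⊥-elim)
open import Data.Unit using (tt)
open import Function using (_∘_; Equivalence)
open import Relation.Nullary using (yes; no)
open import Relation.Binary.PropositionalEquality using (_≡_; refl; sym; trans; cong; cong₂; subst; module ≡-Reasoning)
open import Algebra.Properties.CommutativeSemigroup +-commutativeSemigroup using (interchange)
open import Data.Integer using (ℤ) renaming (+_ to ⁺_; _+_ to _+ℤ_; _-_ to _-ℤ_; _*_ to _*ℤ_)
import Data.Integer.Properties as ℤₚ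
import Data.Integer.Tactic.RingSolver as ℤ-Solver

T-∧⁻ˡ : ∀ {b c} → T (b ∧ c) → T b
T-∧⁻ˡ t = proj₁ (Equivalence.to T-∧ t)

T-∧⁻ʳ : ∀ {b c} → T (b ∧ c) → T c
T-∧⁻ʳ {b} t = proj₂ (Equivalence.to (T-∧ {b}) t)

T-∧⁺ : ∀ {b c} → T b → T c → T (b ∧ c)
T-∧⁺ s t = Equivalence.from T-∧ (s , t)

T-∨⁻ : ∀ {b c} → T (b ∨ c) → T b ⊎ T c
T-∨⁻ = Equivalence.to T-∨

T-∨⁺ˡ : ∀ {b c} → T b → T (b ∨ c)
T-∨⁺ˡ t = Equivalence.from T-∨ (inj₁ t)

T-∨⁺ʳ : ∀ {b c} → T c → T (b ∨ c)
T-∨⁺ʳ {b} t = Equivalence.from (T-∨ {b}) (inj₂ t)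

T-not⁻ : ∀ {b} → T (not b) → T b → ⊥
T-not⁻ {true} () _

T-not⁺ : ∀ {b} → (T b → ⊥) → T (not b)
T-not⁺ {true} h = h tt
T-not⁺ {false} _ = tt

T⇒≡true : ∀ {b} → T b → b ≡ true
T⇒≡true = Equivalence.to T-≡

¬T⇒≡false : ∀ {b} → (T b → ⊥) → b ≡ false
¬T⇒≡false {true} h = ⊥-elim (h tt)
¬T⇒≡false {false} _ = refl

Bool-ext : ∀ {b c} → (T b → T c) → (T c → T b) → b ≡ c
Bool-ext {true} {true} _ _ = refl
Bool-ext {true} {false} f _ = ⊥-elim (f tt)
Bool-ext {false} {true} _ g = ⊥-elim (g tt)
Bool-ext {false} {false} _ _ = refl

<ᵇ-true : ∀ {m n} → m < n → (m <ᵇ n) ≡ true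
<ᵇ-true p = T⇒≡true (<⇒<ᵇ p)

<ᵇ-false : ∀ {m n} → (m < n → ⊥) → (m <ᵇ n) ≡ false
<ᵇ-false {m} {n} h = ¬T⇒≡false (h ∘ <ᵇ⇒< m n)

≡ᵇ-false : ∀ {m n} → (m ≡ n → ⊥) → (m ≡ᵇ n) ≡ false
≡ᵇ-false {m} {n} h = ¬T⇒≡false (h ∘ ≡ᵇ⇒≡ m n)

≡ᵇ-sym : ∀ m n → (m ≡ᵇ n) ≡ (n ≡ᵇ m)
≡ᵇ-sym m n = Bool-ext (λ t → ≡⇒≡ᵇ n m (sym (≡ᵇ⇒≡ m n t))) (λ t → ≡⇒≡ᵇ m n (sym (≡ᵇ⇒≡ n m t)))

-- Iverson bracket: every count below is a sum of brackets, which turns the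
-- Boolean connectives of the counted conditions into arithmetic.
𝟙 : Bool → ℕ
𝟙 true = 1
𝟙 false = 0

𝟙-∧ : ∀ b c → 𝟙 (b ∧ c) ≡ 𝟙 b * 𝟙 c
𝟙-∧ true c = sym (+-identityʳ (𝟙 c))
𝟙-∧ false c = refl

𝟙-∨ : ∀ b c → (T b → T c → ⊥) → 𝟙 (b ∨ c) ≡ 𝟙 b + 𝟙 c
𝟙-∨ true true h = ⊥-elim (h tt tt)
𝟙-∨ true false _ = refl
𝟙-∨ false c _ = refl

𝟙≤1 : ∀ b → 𝟙 b ≤ 1
𝟙≤1 true = s≤s z≤n
𝟙≤1 false = z≤n

𝟙≡1⇒T : ∀ {b} → 𝟙 b ≡ 1 → T b
𝟙≡1⇒T {true} _ = tt

∑ : {X : Set} → (X → ℕ) → List X → ℕ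
∑ f [] = 0
∑ f (x ∷ xs) = f x + ∑ f xs

∑-++ : {X : Set} (f : X → ℕ) (xs ys : List X) → ∑ f (xs ++ ys) ≡ ∑ f xs + ∑ f ys
∑-++ f [] ys = refl
∑-++ f (x ∷ xs) ys = trans (cong (f x +_) (∑-++ f xs ys)) (sym (+-assoc (f x) _ _))

∑-map : {X Y : Set} (f : Y → ℕ) (g : X → Y) (xs : List X) → ∑ f (map g xs) ≡ ∑ (f ∘ g) xs
∑-map f g [] = refl
∑-map f g (x ∷ xs) = cong (f (g x) +_) (∑-map f g xs)

∑-concatMap : {X Y : Set} (f : Y → ℕ) (g : X → List Y) (xs : List X) →
  ∑ f (concatMap g xs) ≡ ∑ (λ x → ∑ f (g x)) xs
∑-concatMap f g [] = refl
∑-concatMap f g (x ∷ xs) =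
  trans (∑-++ f (g x) (concatMap g xs)) (cong (∑ f (g x) +_) (∑-concatMap f g xs))

∑-cong : {X : Set} {f g : X → ℕ} (xs : List X) → (∀ x → f x ≡ g x) → ∑ f xs ≡ ∑ g xs
∑-cong [] e = refl
∑-cong (x ∷ xs) e = cong₂ _+_ (e x) (∑-cong xs e)

∑-zero : {X : Set} (xs : List X) → ∑ (λ _ → 0) xs ≡ 0
∑-zero [] = refl
∑-zero (x ∷ xs) = ∑-zero xs

∑-+ : {X : Set} (f g : X → ℕ) (xs : List X) → ∑ (λ x → f x + g x) xs ≡ ∑ f xs + ∑ g xs
∑-+ f g [] = refl
∑-+ f g (x ∷ xs) = trans (cong (f x + g x +_) (∑-+ f g xs)) (interchange (f x) (g x) (∑ f xs) (∑ g xs))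

∑-*ˡ : {X : Set} (c : ℕ) (f : X → ℕ) (xs : List X) → ∑ (λ x → c * f x) xs ≡ c * ∑ f xs
∑-*ˡ c f [] = sym (*-zeroʳ c)
∑-*ˡ c f (x ∷ xs) = trans (cong (c * f x +_) (∑-*ˡ c f xs)) (sym (*-distribˡ-+ c (f x) (∑ f xs)))

∑-*ʳ : {X : Set} (c : ℕ) (f : X → ℕ) (xs : List X) → ∑ (λ x → f x * c) xs ≡ ∑ f xs * c
∑-*ʳ c f xs = trans (∑-cong xs (λ x → *-comm (f x) c)) (trans (∑-*ˡ c f xs) (*-comm c (∑ f xs)))

∑-swap : {X Y : Set} (f : X → Y → ℕ) (xs : List X) (ys : List Y) →
  ∑ (λ x → ∑ (f x) ys) xs ≡ ∑ (λ y → ∑ (λ x → f x y) xs) ys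
∑-swap f [] ys = sym (∑-zero ys)
∑-swap f (x ∷ xs) ys =
  trans (cong (∑ (f x) ys +_) (∑-swap f xs ys)) (sym (∑-+ (f x) (λ y → ∑ (λ x′ → f x′ y) xs) ys))

count≡∑ : (p : List ℕ → Bool) (ws : List (List ℕ)) → count p ws ≡ ∑ (λ w → 𝟙 (p w)) ws
count≡∑ p [] = refl
count≡∑ p (w ∷ ws) with p w
... | true = cong suc (count≡∑ p ws)
... | false = count≡∑ p ws

∑-filter : {X : Set} (p : X → Bool) (f : X → ℕ) (ws : List X) →
  ∑ f (filter (λ w → T? (p w)) ws) ≡ ∑ (λ w → 𝟙 (p w) * f w) ws
∑-filter p f [] = refl
∑-filter p f (w ∷ ws) with p w
... | true = cong₂ _+_ (sym (+-identityʳ (f w))) (∑-filter p f ws)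
... | false = ∑-filter p f ws

∑-upTo-suc : (f : ℕ → ℕ) (n : ℕ) → ∑ f (upTo (suc n)) ≡ ∑ f (upTo n) + f n
∑-upTo-suc f n = begin
    ∑ f (upTo (suc n))             ≡⟨ cong (∑ f) (sym (upTo-∷ʳ n)) ⟩
    ∑ f (upTo n Data.List.∷ʳ n)    ≡⟨ ∑-++ f (upTo n) _ ⟩
    ∑ f (upTo n) + (f n + 0)       ≡⟨ cong (∑ f (upTo n) +_) (+-identityʳ (f n)) ⟩
    ∑ f (upTo n) + f n             ∎
  where open ≡-Reasoning

∑-upTo-cong : {f g : ℕ → ℕ} (n : ℕ) → (∀ j → j < n → f j ≡ g j) → ∑ f (upTo n) ≡ ∑ g (upTo n)
∑-upTo-cong {f} {g} zero e = refl
∑-upTo-cong {f} {g} (suc n) e = begin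
    ∑ f (upTo (suc n))    ≡⟨ ∑-upTo-suc f n ⟩
    ∑ f (upTo n) + f n    ≡⟨ cong₂ _+_ (∑-upTo-cong n (λ j j<n → e j (m<n⇒m<1+n j<n))) (e n ≤-refl) ⟩
    ∑ g (upTo n) + g n    ≡⟨ sym (∑-upTo-suc g n) ⟩
    ∑ g (upTo (suc n))    ∎
  where open ≡-Reasoning

∑-upTo-vanish : {f : ℕ → ℕ} (n : ℕ) → (∀ j → j < n → f j ≡ 0) → ∑ f (upTo n) ≡ 0
∑-upTo-vanish n e = trans (∑-upTo-cong n e) (∑-zero (upTo n))

∑-upTo-below : (a d : ℕ) (h : ℕ → ℕ) → ∑ (λ v → 𝟙 (v <ᵇ a) * h v) (upTo (a + d)) ≡ ∑ h (upTo a)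
∑-upTo-below a zero h = trans (cong (∑ (λ v → 𝟙 (v <ᵇ a) * h v) ∘ upTo) (+-identityʳ a))
  (∑-upTo-cong a (λ v v<a → trans (cong (λ b → 𝟙 b * h v) (<ᵇ-true v<a)) (*-identityˡ (h v))))
∑-upTo-below a (suc d) h = begin
    ∑ F (upTo (a + suc d))          ≡⟨ cong (∑ F ∘ upTo) (+-suc a d) ⟩
    ∑ F (upTo (suc (a + d)))        ≡⟨ ∑-upTo-suc F (a + d) ⟩
    ∑ F (upTo (a + d)) + F (a + d)  ≡⟨ cong₂ _+_ (∑-upTo-below a d h) (cong (λ b → 𝟙 b * h (a + d)) (<ᵇ-false (m+n≮m a d))) ⟩
    ∑ h (upTo a) + 0                ≡⟨ +-identityʳ _ ⟩
    ∑ h (upTo a)                    ∎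
  where
  open ≡-Reasoning
  F = λ v → 𝟙 (v <ᵇ a) * h v

∑-upTo-above : (a b : ℕ) (h : ℕ → ℕ) → ∑ (λ v → 𝟙 (not (v <ᵇ a)) * h v) (upTo (a + b)) ≡ ∑ (λ j → h (a + j)) (upTo b)
∑-upTo-above a zero h = trans (cong (∑ (λ v → 𝟙 (not (v <ᵇ a)) * h v) ∘ upTo) (+-identityʳ a))
  (∑-upTo-vanish a (λ v v<a → cong (λ b → 𝟙 (not b) * h v) (<ᵇ-true v<a)))
∑-upTo-above a (suc b) h = begin
    ∑ F (upTo (a + suc b))          ≡⟨ cong (∑ F ∘ upTo) (+-suc a b) ⟩
    ∑ F (upTo (suc (a + b)))        ≡⟨ ∑-upTo-suc F (a + b) ⟩
    ∑ F (upTo (a + b)) + F (a + b)  ≡⟨ cong₂ _+_ (∑-upTo-above a b h) last ⟩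
    ∑ G (upTo b) + G b              ≡⟨ sym (∑-upTo-suc G b) ⟩
    ∑ G (upTo (suc b))              ∎
  where
  open ≡-Reasoning
  F = λ v → 𝟙 (not (v <ᵇ a)) * h v
  G = λ j → h (a + j)
  last : F (a + b) ≡ G b
  last = trans (cong (λ c → 𝟙 (not c) * h (a + b)) (<ᵇ-false (m+n≮m a b))) (*-identityˡ (h (a + b)))

∑-upTo-pick-none : (t n : ℕ) (h : ℕ → ℕ) → n ≤ t → ∑ (λ c → 𝟙 (t ≡ᵇ c) * h c) (upTo n) ≡ 0
∑-upTo-pick-none t n h n≤t = ∑-upTo-vanish n
  (λ j j<n → cong (λ b → 𝟙 b * h j) (≡ᵇ-false (λ t≡j → <⇒≢ (<-≤-trans j<n n≤t) (sym t≡j))))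

∑-upTo-pick : (t n : ℕ) (h : ℕ → ℕ) → t < n → ∑ (λ c → 𝟙 (t ≡ᵇ c) * h c) (upTo n) ≡ h t
∑-upTo-pick t (suc n) h t<1+n with m≤n⇒m<n∨m≡n (≤-pred t<1+n)
... | inj₁ t<n = begin
    ∑ F (upTo (suc n))    ≡⟨ ∑-upTo-suc F n ⟩
    ∑ F (upTo n) + F n    ≡⟨ cong₂ _+_ (∑-upTo-pick t n h t<n) (cong (λ b → 𝟙 b * h n) (≡ᵇ-false (<⇒≢ t<n))) ⟩
    h t + 0               ≡⟨ +-identityʳ (h t) ⟩
    h t                   ∎
  where
  open ≡-Reasoning
  F = λ c → 𝟙 (t ≡ᵇ c) * h c
... | inj₂ refl = begin
    ∑ F (upTo (suc t))    ≡⟨ ∑-upTo-suc F t ⟩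
    ∑ F (upTo t) + F t    ≡⟨ cong₂ _+_ (∑-upTo-pick-none t t h ≤-refl) (cong (λ b → 𝟙 b * h t) (T⇒≡true (≡⇒≡ᵇ t t refl))) ⟩
    0 + (h t + 0)         ≡⟨ +-identityʳ (h t) ⟩
    h t                   ∎
  where
  open ≡-Reasoning
  F = λ c → 𝟙 (t ≡ᵇ c) * h c

∑₁ : ℕ → (ℕ → ℕ) → ℕ
∑₁ zero h = 0
∑₁ (suc M) h = ∑₁ M h + h (suc M)

∑₁-cong : ∀ M {f g : ℕ → ℕ} → (∀ m → 1 ≤ m → m ≤ M → f m ≡ g m) → ∑₁ M f ≡ ∑₁ M g
∑₁-cong zero e = refl
∑₁-cong (suc M) e =
  cong₂ _+_ (∑₁-cong M (λ m 1≤m m≤M → e m 1≤m (m≤n⇒m≤1+n m≤M))) (e (suc M) (s≤s z≤n) ≤-refl)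

∑₁-zero : ∀ M → ∑₁ M (λ _ → 0) ≡ 0
∑₁-zero zero = refl
∑₁-zero (suc M) = trans (+-identityʳ _) (∑₁-zero M)

∑₁-+ : ∀ M (f g : ℕ → ℕ) → ∑₁ M (λ m → f m + g m) ≡ ∑₁ M f + ∑₁ M g
∑₁-+ zero f g = refl
∑₁-+ (suc M) f g =
  trans (cong (_+ (f (suc M) + g (suc M))) (∑₁-+ M f g)) (interchange (∑₁ M f) (∑₁ M g) (f (suc M)) (g (suc M)))

∑₁-*ˡ : ∀ M c (f : ℕ → ℕ) → ∑₁ M (λ m → c * f m) ≡ c * ∑₁ M f
∑₁-*ˡ zero c f = sym (*-zeroʳ c)
∑₁-*ˡ (suc M) c f = trans (cong (_+ c * f (suc M)) (∑₁-*ˡ M c f)) (sym (*-distribˡ-+ c (∑₁ M f) (f (suc M))))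

∑₁-pick-none : ∀ M L (h : ℕ → ℕ) → M < L → ∑₁ M (λ m → 𝟙 (m ≡ᵇ L) * h m) ≡ 0
∑₁-pick-none zero L h _ = refl
∑₁-pick-none (suc M) L h M<L = cong₂ _+_ (∑₁-pick-none M L h (<-trans (n<1+n M) M<L))
  (cong (λ b → 𝟙 b * h (suc M)) (≡ᵇ-false (<⇒≢ M<L)))

∑₁-pick : ∀ M L (h : ℕ → ℕ) → 1 ≤ L → L ≤ M → ∑₁ M (λ m → 𝟙 (m ≡ᵇ L) * h m) ≡ h L
∑₁-pick zero L h 1≤L L≤0 = ⊥-elim (<⇒≱ 1≤L L≤0)
∑₁-pick (suc M) L h 1≤L L≤1+M with m≤n⇒m<n∨m≡n L≤1+M
... | inj₁ L<1+M = trans (cong₂ _+_ (∑₁-pick M L h 1≤L (≤-pred L<1+M))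
                                   (cong (λ b → 𝟙 b * h (suc M)) (≡ᵇ-false (λ M+1≡L → <⇒≢ L<1+M (sym M+1≡L)))))
                         (+-identityʳ (h L))
... | inj₂ refl = trans (cong₂ _+_ (∑₁-pick-none M (suc M) h ≤-refl)
                                  (cong (λ b → 𝟙 b * h (suc M)) (T⇒≡true (≡⇒≡ᵇ (suc M) (suc M) refl))))
                        (+-identityʳ (h (suc M)))

∑-∑₁ : {X : Set} (M : ℕ) (f : X → ℕ → ℕ) (xs : List X) → ∑ (λ x → ∑₁ M (f x)) xs ≡ ∑₁ M (λ m → ∑ (λ x → f x m) xs)
∑-∑₁ M f [] = sym (∑₁-zero M)
∑-∑₁ M f (x ∷ xs) = trans (cong (∑₁ M (f x) +_) (∑-∑₁ M f xs)) (sym (∑₁-+ M (f x) (λ m → ∑ (λ x′ → f x′ m) xs)))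

∑-upTo≡head+∑₁ : ∀ n (h : ℕ → ℕ) → ∑ h (upTo (suc n)) ≡ h 0 + ∑₁ n h
∑-upTo≡head+∑₁ zero h = refl
∑-upTo≡head+∑₁ (suc n) h = begin
    ∑ h (upTo (suc (suc n)))           ≡⟨ ∑-upTo-suc h (suc n) ⟩
    ∑ h (upTo (suc n)) + h (suc n)     ≡⟨ cong (_+ h (suc n)) (∑-upTo≡head+∑₁ n h) ⟩
    h 0 + ∑₁ n h + h (suc n)           ≡⟨ +-assoc (h 0) _ _ ⟩
    h 0 + ∑₁ (suc n) h                 ∎
  where open ≡-Reasoning

∑₁-∑-distrib : {X : Set} (M : ℕ) (xs : List X) (c : ℕ) (f : ℕ → ℕ) (g : X → ℕ) →
  c * (∑₁ M f * ∑ g xs) ≡ ∑₁ M (λ m → ∑ (λ l → c * (f m * g l)) xs)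
∑₁-∑-distrib M xs c f g = begin
    c * (∑₁ M f * ∑ g xs)                           ≡⟨ cong (c *_) (sym (trans (∑₁-*ˡ M (∑ g xs) f) (*-comm (∑ g xs) (∑₁ M f)))) ⟩
    c * ∑₁ M (λ m → ∑ g xs * f m)                   ≡⟨ sym (∑₁-*ˡ M c _) ⟩
    ∑₁ M (λ m → c * (∑ g xs * f m))                 ≡⟨ ∑₁-cong M (λ m _ _ → cong (c *_) (trans (*-comm (∑ g xs) (f m)) (sym (∑-*ˡ (f m) g xs)))) ⟩
    ∑₁ M (λ m → c * ∑ (λ l → f m * g l) xs)         ≡⟨ ∑₁-cong M (λ m _ _ → sym (∑-*ˡ c _ xs)) ⟩
    ∑₁ M (λ m → ∑ (λ l → c * (f m * g l)) xs)       ∎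
  where open ≡-Reasoning

allBelow : ℕ → List ℕ → Bool
allBelow a w = all (λ v → v <ᵇ a) w

allAtLeast : ℕ → List ℕ → Bool
allAtLeast a w = all (λ v → not (v <ᵇ a)) w

∑-words-suc : (f : List ℕ → ℕ) (n m : ℕ) →
  ∑ f (words n (suc m)) ≡ ∑ (λ v → ∑ (λ w → f (v ∷ w)) (words n m)) (upTo n)
∑-words-suc f n m =
  trans (∑-concatMap f _ (upTo n)) (∑-cong (upTo n) (λ v → ∑-map f (v ∷_) (words n m)))

∑-words-++ : (f : List ℕ → ℕ) (n a b : ℕ) →
  ∑ f (words n (a + b)) ≡ ∑ (λ x → ∑ (λ y → f (x ++ y)) (words n b)) (words n a)
∑-words-++ f n zero b = sym (+-identityʳ _)
∑-words-++ f n (suc a) b = begin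
    ∑ f (words n (suc a + b))
  ≡⟨ ∑-words-suc f n (a + b) ⟩
    ∑ (λ v → ∑ (λ w → f (v ∷ w)) (words n (a + b))) (upTo n)
  ≡⟨ ∑-cong (upTo n) (λ v → ∑-words-++ (λ w → f (v ∷ w)) n a b) ⟩
    ∑ (λ v → ∑ (λ x → ∑ (λ y → f (v ∷ x ++ y)) (words n b)) (words n a)) (upTo n)
  ≡⟨ sym (∑-words-suc _ n a) ⟩
    ∑ (λ x → ∑ (λ y → f (x ++ y)) (words n b)) (words n (suc a)) ∎
  where open ≡-Reasoning

∑-words-cong : {f g : List ℕ → ℕ} (n m : ℕ) →
  (∀ w → length w ≡ m → T (allBelow n w) → f w ≡ g w) → ∑ f (words n m) ≡ ∑ g (words n m)
∑-words-cong n zero e = cong (_+ 0) (e [] refl tt)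
∑-words-cong {f} {g} n (suc m) e = begin
    ∑ f (words n (suc m))                                 ≡⟨ ∑-words-suc f n m ⟩
    ∑ (λ v → ∑ (λ w → f (v ∷ w)) (words n m)) (upTo n)    ≡⟨ ∑-upTo-cong n (λ v v<n → ∑-words-cong n m (λ w lw t → e (v ∷ w) (cong suc lw) (T-∧⁺ (<⇒<ᵇ v<n) t))) ⟩
    ∑ (λ v → ∑ (λ w → g (v ∷ w)) (words n m)) (upTo n)    ≡⟨ sym (∑-words-suc g n m) ⟩
    ∑ g (words n (suc m))                                 ∎
  where open ≡-Reasoning

∑-words-below : (a d m : ℕ) (g : List ℕ → ℕ) →
  ∑ (λ x → 𝟙 (allBelow a x) * g x) (words (a + d) m) ≡ ∑ g (words a m)
∑-words-below a d zero g = cong (_+ 0) (*-identityˡ (g []))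
∑-words-below a d (suc m) g = begin
    ∑ (λ x → 𝟙 (allBelow a x) * g x) (words (a + d) (suc m))
  ≡⟨ ∑-words-suc _ (a + d) m ⟩
    ∑ (λ v → ∑ (λ w → 𝟙 ((v <ᵇ a) ∧ allBelow a w) * g (v ∷ w)) (words (a + d) m)) (upTo (a + d))
  ≡⟨ ∑-cong (upTo (a + d)) factor ⟩
    ∑ (λ v → 𝟙 (v <ᵇ a) * ∑ (λ w → g (v ∷ w)) (words a m)) (upTo (a + d))
  ≡⟨ ∑-upTo-below a d _ ⟩
    ∑ (λ v → ∑ (λ w → g (v ∷ w)) (words a m)) (upTo a)
  ≡⟨ sym (∑-words-suc g a m) ⟩
    ∑ g (words a (suc m)) ∎
  where
  open ≡-Reasoning
  factor : ∀ v → ∑ (λ w → 𝟙 ((v <ᵇ a) ∧ allBelow a w) * g (v ∷ w)) (words (a + d) m)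
                 ≡ 𝟙 (v <ᵇ a) * ∑ (λ w → g (v ∷ w)) (words a m)
  factor v = begin
      ∑ (λ w → 𝟙 ((v <ᵇ a) ∧ allBelow a w) * g (v ∷ w)) (words (a + d) m)
    ≡⟨ ∑-cong (words (a + d) m) (λ w → trans (cong (_* g (v ∷ w)) (𝟙-∧ (v <ᵇ a) _)) (*-assoc (𝟙 (v <ᵇ a)) _ _)) ⟩
      ∑ (λ w → 𝟙 (v <ᵇ a) * (𝟙 (allBelow a w) * g (v ∷ w))) (words (a + d) m)
    ≡⟨ ∑-*ˡ (𝟙 (v <ᵇ a)) _ (words (a + d) m) ⟩
      𝟙 (v <ᵇ a) * ∑ (λ w → 𝟙 (allBelow a w) * g (v ∷ w)) (words (a + d) m)
    ≡⟨ cong (𝟙 (v <ᵇ a) *_) (∑-words-below a d m (λ w → g (v ∷ w))) ⟩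
      𝟙 (v <ᵇ a) * ∑ (λ w → g (v ∷ w)) (words a m) ∎

shift : ℕ → List ℕ → List ℕ
shift a = map (a +_)

∑-words-above : (a b m : ℕ) (g : List ℕ → ℕ) →
  ∑ (λ y → 𝟙 (allAtLeast a y) * g y) (words (a + b) m) ≡ ∑ (λ y → g (shift a y)) (words b m)
∑-words-above a b zero g = cong (_+ 0) (*-identityˡ (g []))
∑-words-above a b (suc m) g = begin
    ∑ (λ y → 𝟙 (allAtLeast a y) * g y) (words (a + b) (suc m))
  ≡⟨ ∑-words-suc _ (a + b) m ⟩
    ∑ (λ v → ∑ (λ w → 𝟙 (not (v <ᵇ a) ∧ allAtLeast a w) * g (v ∷ w)) (words (a + b) m)) (upTo (a + b))
  ≡⟨ ∑-cong (upTo (a + b)) factor ⟩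
    ∑ (λ v → 𝟙 (not (v <ᵇ a)) * ∑ (λ w → g (v ∷ shift a w)) (words b m)) (upTo (a + b))
  ≡⟨ ∑-upTo-above a b _ ⟩
    ∑ (λ j → ∑ (λ w → g ((a + j) ∷ shift a w)) (words b m)) (upTo b)
  ≡⟨ sym (∑-words-suc (λ y → g (shift a y)) b m) ⟩
    ∑ (λ y → g (shift a y)) (words b (suc m)) ∎
  where
  open ≡-Reasoning
  factor : ∀ v → ∑ (λ w → 𝟙 (not (v <ᵇ a) ∧ allAtLeast a w) * g (v ∷ w)) (words (a + b) m)
                 ≡ 𝟙 (not (v <ᵇ a)) * ∑ (λ w → g (v ∷ shift a w)) (words b m)
  factor v = begin
      ∑ (λ w → 𝟙 (not (v <ᵇ a) ∧ allAtLeast a w) * g (v ∷ w)) (words (a + b) m)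
    ≡⟨ ∑-cong (words (a + b) m) (λ w → trans (cong (_* g (v ∷ w)) (𝟙-∧ (not (v <ᵇ a)) _)) (*-assoc (𝟙 (not (v <ᵇ a))) _ _)) ⟩
      ∑ (λ w → 𝟙 (not (v <ᵇ a)) * (𝟙 (allAtLeast a w) * g (v ∷ w))) (words (a + b) m)
    ≡⟨ ∑-*ˡ (𝟙 (not (v <ᵇ a))) _ (words (a + b) m) ⟩
      𝟙 (not (v <ᵇ a)) * ∑ (λ w → 𝟙 (allAtLeast a w) * g (v ∷ w)) (words (a + b) m)
    ≡⟨ cong (𝟙 (not (v <ᵇ a)) *_) (∑-words-above a b m (λ w → g (v ∷ w))) ⟩
      𝟙 (not (v <ᵇ a)) * ∑ (λ w → g (v ∷ shift a w)) (words b m) ∎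

count-perms : (p : List ℕ → Bool) (n : ℕ) → count p (perms n) ≡ ∑ (λ w → 𝟙 (distinct w) * 𝟙 (p w)) (words n n)
count-perms p n = trans (count≡∑ p (perms n)) (∑-filter distinct (λ w → 𝟙 (p w)) (words n n))

∈-here : ∀ x xs → T (x ∈ᵇ (x ∷ xs))
∈-here x xs = T-∨⁺ˡ (≡⇒≡ᵇ x x refl)

∈-there : ∀ {v} x xs → T (v ∈ᵇ xs) → T (v ∈ᵇ (x ∷ xs))
∈-there x xs = T-∨⁺ʳ

∈-∷⁻ : ∀ {v} x xs → T (v ∈ᵇ (x ∷ xs)) → v ≡ x ⊎ T (v ∈ᵇ xs)
∈-∷⁻ {v} x xs t with T-∨⁻ {v ≡ᵇ x} t
... | inj₁ v≡x = inj₁ (≡ᵇ⇒≡ v x v≡x)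
... | inj₂ v∈xs = inj₂ v∈xs

∈-++⁻ : ∀ {v} xs ys → T (v ∈ᵇ (xs ++ ys)) → T (v ∈ᵇ xs) ⊎ T (v ∈ᵇ ys)
∈-++⁻ [] ys t = inj₂ t
∈-++⁻ (x ∷ xs) ys t with ∈-∷⁻ x (xs ++ ys) t
... | inj₁ refl = inj₁ (∈-here x xs)
... | inj₂ t′ with ∈-++⁻ xs ys t′
...   | inj₁ v∈xs = inj₁ (∈-there x xs v∈xs)
...   | inj₂ v∈ys = inj₂ v∈ys

∈-++⁺ˡ : ∀ {v} xs ys → T (v ∈ᵇ xs) → T (v ∈ᵇ (xs ++ ys))
∈-++⁺ˡ (x ∷ xs) ys t with ∈-∷⁻ x xs t
... | inj₁ refl = ∈-here x (xs ++ ys)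
... | inj₂ t′ = ∈-there x (xs ++ ys) (∈-++⁺ˡ xs ys t′)

∈-++⁺ʳ : ∀ {v} xs ys → T (v ∈ᵇ ys) → T (v ∈ᵇ (xs ++ ys))
∈-++⁺ʳ [] ys t = t
∈-++⁺ʳ (x ∷ xs) ys t = ∈-there x (xs ++ ys) (∈-++⁺ʳ xs ys t)

all⁻ : ∀ {p : ℕ → Bool} w → T (all p w) → ∀ v → T (v ∈ᵇ w) → T (p v)
all⁻ (x ∷ w) t v v∈ with ∈-∷⁻ x w v∈
... | inj₁ refl = T-∧⁻ˡ t
... | inj₂ v∈w = all⁻ w (T-∧⁻ʳ t) v v∈w

all⁺ : ∀ {p : ℕ → Bool} w → (∀ v → T (v ∈ᵇ w) → T (p v)) → T (all p w)
all⁺ [] h = tt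
all⁺ (x ∷ w) h = T-∧⁺ (h x (∈-here x w)) (all⁺ w (λ v v∈ → h v (∈-there x w v∈)))

all-upTo⁺ : ∀ {p : ℕ → Bool} n → (∀ j → j < n → T (p j)) → T (all p (upTo n))
all-upTo⁺ {p} n h = all⁺ (upTo n) (λ v v∈ → h v (∈-upTo⁻ n v∈))
  where
  ∈-applyUpTo⁻ : ∀ {v} (f : ℕ → ℕ) n → T (v ∈ᵇ applyUpTo f n) → Σ ℕ λ j → j < n × v ≡ f j
  ∈-applyUpTo⁻ f (suc n) v∈ with ∈-∷⁻ (f 0) (applyUpTo (f ∘ suc) n) v∈
  ... | inj₁ v≡f0 = 0 , s≤s z≤n , v≡f0
  ... | inj₂ v∈rest with ∈-applyUpTo⁻ (f ∘ suc) n v∈rest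
  ...   | j , j<n , v≡ = suc j , s≤s j<n , v≡
  ∈-upTo⁻ : ∀ {v} n → T (v ∈ᵇ upTo n) → v < n
  ∈-upTo⁻ n v∈ with ∈-applyUpTo⁻ (λ j → j) n v∈
  ... | j , j<n , refl = j<n

Disjoint : List ℕ → List ℕ → Set
Disjoint xs ys = ∀ v → T (v ∈ᵇ xs) → T (v ∈ᵇ ys) → ⊥

distinct-++⁻ : ∀ xs ys → T (distinct (xs ++ ys)) → T (distinct xs) × T (distinct ys) × Disjoint xs ys
distinct-++⁻ [] ys t = tt , t , (λ v ())
distinct-++⁻ (x ∷ xs) ys t with distinct-++⁻ xs ys (T-∧⁻ʳ t)
... | dxs , dys , disj = T-∧⁺ (T-not⁺ (T-not⁻ (T-∧⁻ˡ t) ∘ ∈-++⁺ˡ xs ys)) dxs , dys , disj′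
  where
  disj′ : Disjoint (x ∷ xs) ys
  disj′ v v∈ v∈ys with ∈-∷⁻ x xs v∈
  ... | inj₁ refl = T-not⁻ (T-∧⁻ˡ t) (∈-++⁺ʳ xs ys v∈ys)
  ... | inj₂ v∈xs = disj v v∈xs v∈ys

distinct-++⁺ : ∀ xs ys → T (distinct xs) → T (distinct ys) → Disjoint xs ys → T (distinct (xs ++ ys))
distinct-++⁺ [] ys _ dys _ = dys
distinct-++⁺ (x ∷ xs) ys dxs dys disj =
  T-∧⁺ (T-not⁺ x∉) (distinct-++⁺ xs ys (T-∧⁻ʳ dxs) dys (λ v v∈ → disj v (∈-there x xs v∈)))
  where
  x∉ : T (x ∈ᵇ (xs ++ ys)) → ⊥
  x∉ x∈ with ∈-++⁻ xs ys x∈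
  ... | inj₁ x∈xs = T-not⁻ (T-∧⁻ˡ dxs) x∈xs
  ... | inj₂ x∈ys = disj x (∈-here x xs) x∈ys

-- Pigeonhole: a duplicate-free word of length a with letters in [0, a) uses
-- every letter.  Its letters are counted by a sum of brackets equal to a, and
-- a sum of a brackets equal to a has all brackets equal to 1.

∑-upTo-≤ : (f : ℕ → ℕ) (n : ℕ) → (∀ j → f j ≤ 1) → ∑ f (upTo n) ≤ n
∑-upTo-≤ f zero _ = z≤n
∑-upTo-≤ f (suc n) f≤1 = begin
    ∑ f (upTo (suc n))  ≡⟨ ∑-upTo-suc f n ⟩
    ∑ f (upTo n) + f n  ≤⟨ +-mono-≤ (∑-upTo-≤ f n f≤1) (f≤1 n) ⟩
    n + 1               ≡⟨ +-comm n 1 ⟩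
    suc n               ∎
  where open ≤-Reasoning

tight-sum : ∀ {s t n} → s ≤ n → t ≤ 1 → s + t ≡ suc n → s ≡ n × t ≡ 1
tight-sum {s} {t} {n} s≤n t≤1 s+t≡ = +-cancelʳ-≡ 1 s n (trans (cong (s +_) (sym t≡1)) (trans s+t≡ (+-comm 1 n))) , t≡1
  where
  t≡1 : t ≡ 1
  t≡1 = ≤-antisym t≤1 (+-cancelˡ-≤ n 1 t (begin
    n + 1   ≡⟨ trans (+-comm n 1) (sym s+t≡) ⟩
    s + t   ≤⟨ +-monoˡ-≤ t s≤n ⟩
    n + t   ∎))
    where open ≤-Reasoning

∑-upTo-saturated : (f : ℕ → ℕ) (n : ℕ) → (∀ j → f j ≤ 1) → ∑ f (upTo n) ≡ n → ∀ j → j < n → f j ≡ 1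
∑-upTo-saturated f (suc n) f≤1 sum≡ j j<1+n
  with tight-sum (∑-upTo-≤ f n f≤1) (f≤1 n) (trans (sym (∑-upTo-suc f n)) sum≡) | m≤n⇒m<n∨m≡n (≤-pred j<1+n)
... | rest≡n , _ | inj₁ j<n = ∑-upTo-saturated f n f≤1 rest≡n j j<n
... | _ , last≡1 | inj₂ refl = last≡1

∑-members : ∀ x a → T (distinct x) → T (allBelow a x) → ∑ (λ v → 𝟙 (v ∈ᵇ x)) (upTo a) ≡ length x
∑-members [] a _ _ = ∑-zero (upTo a)
∑-members (e ∷ x) a dx lx = begin
    ∑ (λ v → 𝟙 ((v ≡ᵇ e) ∨ (v ∈ᵇ x))) (upTo a)
  ≡⟨ ∑-cong (upTo a) (λ v → 𝟙-∨ (v ≡ᵇ e) (v ∈ᵇ x) (λ v≡e v∈x → T-not⁻ (T-∧⁻ˡ dx) (subst (λ z → T (z ∈ᵇ x)) (≡ᵇ⇒≡ v e v≡e) v∈x))) ⟩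
    ∑ (λ v → 𝟙 (v ≡ᵇ e) + 𝟙 (v ∈ᵇ x)) (upTo a)
  ≡⟨ ∑-+ _ _ (upTo a) ⟩
    ∑ (λ v → 𝟙 (v ≡ᵇ e)) (upTo a) + ∑ (λ v → 𝟙 (v ∈ᵇ x)) (upTo a)
  ≡⟨ cong₂ _+_ e-once (∑-members x a (T-∧⁻ʳ dx) (T-∧⁻ʳ lx)) ⟩
    suc (length x) ∎
  where
  open ≡-Reasoning
  e-once : ∑ (λ v → 𝟙 (v ≡ᵇ e)) (upTo a) ≡ 1
  e-once = trans (∑-upTo-cong a (λ v _ → trans (cong 𝟙 (≡ᵇ-sym v e)) (sym (*-identityʳ _))))
                 (∑-upTo-pick e a (λ _ → 1) (<ᵇ⇒< e a (T-∧⁻ˡ lx)))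

pigeonhole : ∀ x a → T (distinct x) → T (allBelow a x) → length x ≡ a → ∀ v → v < a → T (v ∈ᵇ x)
pigeonhole x a dx lx len v v<a = 𝟙≡1⇒T (∑-upTo-saturated (λ v → 𝟙 (v ∈ᵇ x)) a (λ j → 𝟙≤1 (j ∈ᵇ x))
                                          (trans (∑-members x a dx lx) len) v v<a)

≡ᵇ-shift : ∀ a u v → ((a + u) ≡ᵇ (a + v)) ≡ (u ≡ᵇ v)
≡ᵇ-shift zero u v = refl
≡ᵇ-shift (suc a) u v = ≡ᵇ-shift a u v

∈ᵇ-shift : ∀ a u y → ((a + u) ∈ᵇ shift a y) ≡ (u ∈ᵇ y)
∈ᵇ-shift a u [] = refl
∈ᵇ-shift a u (v ∷ y) = cong₂ _∨_ (≡ᵇ-shift a u v) (∈ᵇ-shift a u y)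

distinct-shift : ∀ a y → distinct (shift a y) ≡ distinct y
distinct-shift a [] = refl
distinct-shift a (v ∷ y) = cong₂ (λ p q → not p ∧ q) (∈ᵇ-shift a v y) (distinct-shift a y)

firstFrom-≥ : ∀ w i f → i ≤ firstFrom w i f
firstFrom-≥ w i zero = ≤-refl
firstFrom-≥ w i (suc f) with prefixIsInitial w i
... | true = ≤-refl
... | false = ≤-trans (n≤1+n i) (firstFrom-≥ w (suc i) f)

firstFrom-≤ : ∀ w i f → firstFrom w i f ≤ i + f
firstFrom-≤ w i zero = ≤-reflexive (sym (+-identityʳ i))
firstFrom-≤ w i (suc f) with prefixIsInitial w i
... | true = m≤m+n i (suc f)
... | false = ≤-trans (firstFrom-≤ w (suc i) f) (≤-reflexive (sym (+-suc i f)))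

firstFrom-minimal : ∀ w i f j → i ≤ j → j < firstFrom w i f → prefixIsInitial w j ≡ false
firstFrom-minimal w i zero j i≤j j<r = ⊥-elim (<⇒≱ j<r i≤j)
firstFrom-minimal w i (suc f) j i≤j j<r with prefixIsInitial w i in eq
... | true = ⊥-elim (<⇒≱ j<r i≤j)
... | false with m≤n⇒m<n∨m≡n i≤j
...   | inj₁ i<j = firstFrom-minimal w (suc i) f j i<j j<r
...   | inj₂ refl = eq

firstFrom-stops : ∀ w i f → firstFrom w i f ≡ i + f ⊎ T (prefixIsInitial w (firstFrom w i f))
firstFrom-stops w i zero = inj₁ (sym (+-identityʳ i))
firstFrom-stops w i (suc f) with prefixIsInitial w i in eq
... | true = inj₂ (subst T (sym eq) tt)
... | false with firstFrom-stops w (suc i) f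
...   | inj₁ r≡end = inj₁ (trans r≡end (sym (+-suc i f)))
...   | inj₂ found = inj₂ found

firstFrom-unique : ∀ w i f r → (∀ j → i ≤ j → j < r → prefixIsInitial w j ≡ false) → i ≤ r → r ≤ i + f →
  r ≡ i + f ⊎ T (prefixIsInitial w r) → firstFrom w i f ≡ r
firstFrom-unique w i zero r _ i≤r r≤i+0 _ = ≤-antisym i≤r (≤-trans r≤i+0 (≤-reflexive (+-identityʳ i)))
firstFrom-unique w i (suc f) r below i≤r r≤end stop with m≤n⇒m<n∨m≡n i≤r
... | inj₁ i<r rewrite below i ≤-refl i<r =
  firstFrom-unique w (suc i) f r (λ j 1+i≤j → below j (≤-trans (n≤1+n i) 1+i≤j)) i<r
    (≤-trans r≤end (≤-reflexive (+-suc i f))) (map₁ (λ r≡ → trans r≡ (+-suc i f)) stop)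
... | inj₂ refl with prefixIsInitial w i in eq
...   | true = refl
...   | false with stop
...     | inj₁ i≡end = ⊥-elim (m≢1+m+n i (trans i≡end (+-suc i f)))
...     | inj₂ ()

1+[n∸1] : ∀ {n} → 1 ≤ n → 1 + (n ∸ 1) ≡ n
1+[n∸1] {suc n} _ = refl

iπ-≥1 : ∀ w → 1 ≤ iπ w
iπ-≥1 w = firstFrom-≥ w 1 (length w ∸ 1)

iπ-≤ : ∀ w → 1 ≤ length w → iπ w ≤ length w
iπ-≤ w 1≤n = ≤-trans (firstFrom-≤ w 1 (length w ∸ 1)) (≤-reflexive (1+[n∸1] 1≤n))

iπ-minimal : ∀ w j → 1 ≤ j → j < iπ w → prefixIsInitial w j ≡ false
iπ-minimal w = firstFrom-minimal w 1 (length w ∸ 1)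

iπ-stops : ∀ w → 1 ≤ length w → iπ w ≡ length w ⊎ T (prefixIsInitial w (iπ w))
iπ-stops w 1≤n = map₁ (λ r≡ → trans r≡ (1+[n∸1] 1≤n)) (firstFrom-stops w 1 (length w ∸ 1))

iπ-unique : ∀ w r → (∀ j → 1 ≤ j → j < r → prefixIsInitial w j ≡ false) → 1 ≤ r → r ≤ length w →
  r ≡ length w ⊎ T (prefixIsInitial w r) → iπ w ≡ r
iπ-unique w r below 1≤r r≤n stop = firstFrom-unique w 1 (length w ∸ 1) r below 1≤r
  (≤-trans r≤n (≤-reflexive (sym n≡))) (map₁ (λ r≡n → trans r≡n (sym n≡)) stop)
  where
  n≡ : 1 + (length w ∸ 1) ≡ length w
  n≡ = 1+[n∸1] (≤-trans 1≤r r≤n)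

take-++ : ∀ j (x y : List ℕ) → j ≤ length x → take j (x ++ y) ≡ take j x
take-++ zero x y _ = refl
take-++ (suc j) (e ∷ x) y (s≤s j≤) = cong (e ∷_) (take-++ j x y j≤)

prefixIsInitial-++ : ∀ j x y → j ≤ length x → prefixIsInitial (x ++ y) j ≡ prefixIsInitial x j
prefixIsInitial-++ j x y j≤ = cong (λ t → all (λ v → v ∈ᵇ t) (upTo j) ∧ all (λ v → v <ᵇ j) t) (take-++ j x y j≤)

prefixIsInitial-perm : ∀ x a → length x ≡ a → T (distinct x) → T (allBelow a x) → T (prefixIsInitial x a)
prefixIsInitial-perm x a len dx lx rewrite take-all a x (≤-reflexive len) =
  T-∧⁺ (all-upTo⁺ a (pigeonhole x a dx lx len)) lx

indecomposable-iπ : ∀ x a → length x ≡ a → 1 ≤ a → indecomposable x ≡ (iπ x ≡ᵇ a)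
indecomposable-iπ (e ∷ x) a len _ = cong (iπ (e ∷ x) ≡ᵇ_) len
indecomposable-iπ [] a len 1≤a = ⊥-elim (<⇒≱ 1≤a (≤-reflexive (sym len)))

-- Write a word of length a + b as x ++ y
-- with |x| = a ≥ 1.  It is a permutation with first block of length a iff
-- x is an indecomposable permutation of [a] and y is a duplicate-free word
-- with all letters ≥ a (so that y = a + y′ for a permutation y′ of [b]).

firstBlock⇒ : ∀ x y a → length x ≡ a → 1 ≤ a → T (allBelow (a + length y) x) →
  T (distinct (x ++ y)) → iπ (x ++ y) ≡ a →
  T (allBelow a x) × T (distinct x) × iπ x ≡ a × T (allAtLeast a y) × T (distinct y)
firstBlock⇒ x y a lenx 1≤a x<a+b dxy iπ≡a = x<a , dx , iπx≡a , y≥a , dy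
  where
  a≤|x| : a ≤ length x
  a≤|x| = ≤-reflexive (sym lenx)
  |xy|≡ : length (x ++ y) ≡ a + length y
  |xy|≡ = trans (length-++ x) (cong (_+ length y) lenx)
  parts = distinct-++⁻ x y dxy
  dx = proj₁ parts
  dy = proj₁ (proj₂ parts)
  disjoint = proj₂ (proj₂ parts)
  -- either y is empty, or the prefix x of x ++ y is initial: in both cases x < a
  x<a : T (allBelow a x)
  x<a with iπ-stops (x ++ y) (≤-trans 1≤a (≤-trans a≤|x| (length-++-≤ˡ x)))
  ... | inj₁ iπ≡|xy| = subst (λ n → T (allBelow n x)) (trans (sym |xy|≡) (trans (sym iπ≡|xy|) iπ≡a)) x<a+b
  ... | inj₂ initial = subst (λ z → T (allBelow a z)) (take-all a x (≤-reflexive lenx))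
          (T-∧⁻ʳ (subst T (prefixIsInitial-++ a x y a≤|x|) (subst (λ r → T (prefixIsInitial (x ++ y) r)) iπ≡a initial)))
  -- x contains every letter below a, so y, being disjoint from x, has none
  y≥a : T (allAtLeast a y)
  y≥a = all⁺ y (λ v v∈y → T-not⁺ (λ v<a → disjoint v (pigeonhole x a dx x<a lenx v (<ᵇ⇒< v a v<a)) v∈y))
  iπx≡a : iπ x ≡ a
  iπx≡a = iπ-unique x a
    (λ j 1≤j j<a → trans (sym (prefixIsInitial-++ j x y (≤-trans (<⇒≤ j<a) a≤|x|)))
                         (iπ-minimal (x ++ y) j 1≤j (subst (j <_) (sym iπ≡a) j<a)))
    1≤a a≤|x| (inj₁ (sym lenx))

firstBlock⇐ : ∀ x y a → length x ≡ a → 1 ≤ a →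
  T (allBelow a x) → T (distinct x) → iπ x ≡ a → T (allAtLeast a y) → T (distinct y) →
  T (distinct (x ++ y)) × iπ (x ++ y) ≡ a
firstBlock⇐ x y a lenx 1≤a x<a dx iπx≡a y≥a dy = dxy , iπ≡a
  where
  a≤|x| : a ≤ length x
  a≤|x| = ≤-reflexive (sym lenx)
  dxy : T (distinct (x ++ y))
  dxy = distinct-++⁺ x y dx dy (λ v v∈x v∈y → T-not⁻ (all⁻ y y≥a v v∈y) (all⁻ x x<a v v∈x))
  iπ≡a : iπ (x ++ y) ≡ a
  iπ≡a = iπ-unique (x ++ y) a
    (λ j 1≤j j<a → trans (prefixIsInitial-++ j x y (≤-trans (<⇒≤ j<a) a≤|x|))
                         (iπ-minimal x j 1≤j (subst (j <_) (sym iπx≡a) j<a)))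
    1≤a (≤-trans a≤|x| (length-++-≤ˡ x))
    (inj₂ (subst T (sym (prefixIsInitial-++ a x y a≤|x|)) (prefixIsInitial-perm x a lenx dx x<a)))

firstBlock-split : ∀ x y a → length x ≡ a → 1 ≤ a → T (allBelow (a + length y) x) →
  (distinct (x ++ y) ∧ (iπ (x ++ y) ≡ᵇ a))
    ≡ ((allBelow a x ∧ (distinct x ∧ (iπ x ≡ᵇ a))) ∧ (allAtLeast a y ∧ distinct y))
firstBlock-split x y a lenx 1≤a x<a+b = Bool-ext to from
  where
  to : T (distinct (x ++ y) ∧ (iπ (x ++ y) ≡ᵇ a)) → T ((allBelow a x ∧ (distinct x ∧ (iπ x ≡ᵇ a))) ∧ (allAtLeast a y ∧ distinct y))
  to t with firstBlock⇒ x y a lenx 1≤a x<a+b (T-∧⁻ˡ t) (≡ᵇ⇒≡ _ a (T-∧⁻ʳ t))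
  ... | x<a , dx , iπx≡a , y≥a , dy = T-∧⁺ (T-∧⁺ x<a (T-∧⁺ dx (≡⇒≡ᵇ _ a iπx≡a))) (T-∧⁺ y≥a dy)
  from : T ((allBelow a x ∧ (distinct x ∧ (iπ x ≡ᵇ a))) ∧ (allAtLeast a y ∧ distinct y)) → T (distinct (x ++ y) ∧ (iπ (x ++ y) ≡ᵇ a))
  from t with Equivalence.to T-∧ t
  ... | xs , ys with Equivalence.to T-∧ xs | Equivalence.to T-∧ ys
  ...   | x<a , dx∧iπ | y≥a , dy with Equivalence.to T-∧ dx∧iπ
  ...     | dx , iπx with firstBlock⇐ x y a lenx 1≤a x<a dx (≡ᵇ⇒≡ _ a iπx) y≥a dy
  ...       | dxy , iπ≡a = T-∧⁺ dxy (≡⇒≡ᵇ _ a iπ≡a)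

contains : ℕ → List ℕ → Bool
contains j w = any (λ s → (length s ≡ᵇ j) ∧ increasing s) (subseqs w)

∈-subseqs⁻ : ∀ {s} w → s ∈ subseqs w → s ⊆ w
∈-subseqs⁻ [] (here refl) = []
∈-subseqs⁻ (x ∷ w) s∈ with ∈ₚ.∈-++⁻ (map (x ∷_) (subseqs w)) s∈
... | inj₁ s∈keep with ∈ₚ.∈-map⁻ (x ∷_) s∈keep
...   | t , t∈ , refl = refl ∷ ∈-subseqs⁻ w t∈
∈-subseqs⁻ (x ∷ w) s∈ | inj₂ s∈skip = x ∷ʳ ∈-subseqs⁻ w s∈skip

∈-subseqs⁺ : ∀ {s w} → s ⊆ w → s ∈ subseqs w
∈-subseqs⁺ [] = here refl
∈-subseqs⁺ (refl ∷ s⊆w) = ∈ₚ.∈-++⁺ˡ (∈ₚ.∈-map⁺ (_ ∷_) (∈-subseqs⁺ s⊆w))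
∈-subseqs⁺ {w = x ∷ w} (.x ∷ʳ s⊆w) = ∈ₚ.∈-++⁺ʳ (map (x ∷_) (subseqs w)) (∈-subseqs⁺ s⊆w)

record IncreasingSub (j : ℕ) (w : List ℕ) : Set where
  constructor incSub
  field
    sub : List ℕ
    sub⊆w : sub ⊆ w
    sub-length : length sub ≡ j
    sub-increasing : T (increasing sub)

contains⇒IncreasingSub : ∀ j w → T (contains j w) → IncreasingSub j w
contains⇒IncreasingSub j w t with find (any⁻ _ (subseqs w) t)
... | s , s∈ , ps = incSub s (∈-subseqs⁻ w s∈) (≡ᵇ⇒≡ _ j (T-∧⁻ˡ ps)) (T-∧⁻ʳ ps)

IncreasingSub⇒contains : ∀ j w → IncreasingSub j w → T (contains j w)
IncreasingSub⇒contains j w (incSub s s⊆w len inc) =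
  any⁺ _ (lose (∈-subseqs⁺ s⊆w) (T-∧⁺ (≡⇒≡ᵇ _ j len) inc))

increasing-tail : ∀ x s → T (increasing (x ∷ s)) → T (increasing s)
increasing-tail x [] _ = tt
increasing-tail x (y ∷ s) t = T-∧⁻ʳ t

contains-pred : ∀ j w → T (contains (suc j) w) → T (contains j w)
contains-pred j w t with contains⇒IncreasingSub (suc j) w t
... | incSub (x ∷ s) x∷s⊆w len inc =
  IncreasingSub⇒contains j w (incSub s (∷ˡ⁻ x∷s⊆w) (suc-injective len) (increasing-tail x s inc))

contains-≤ : ∀ j j′ w → j ≤ j′ → T (contains j′ w) → T (contains j w)
contains-≤ j j′ w j≤j′ t with m≤n⇒m<n∨m≡n j≤j′
... | inj₂ refl = t
... | inj₁ (s≤s j≤j′-1) = contains-≤ j _ w j≤j′-1 (contains-pred _ w t)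

contains⇒≤length : ∀ j w → T (contains j w) → j ≤ length w
contains⇒≤length j w t with contains⇒IncreasingSub j w t
... | incSub s s⊆w len _ = subst (_≤ length w) len (length-mono-≤ s⊆w)

contains-0 : ∀ w → T (contains 0 w)
contains-0 w = IncreasingSub⇒contains 0 w (incSub [] (minimum w) refl tt)

contains-1 : ∀ w → 1 ≤ length w → T (contains 1 w)
contains-1 (x ∷ w) _ = IncreasingSub⇒contains 1 (x ∷ w) (incSub (x ∷ []) (refl ∷ minimum w) refl tt)

-- Direct sums.  For x with letters < a, the word x ++ shift a y places a copy
-- of y above and to the right of x; with a = |x| this is x ⊕ y.

<ᵇ-shift : ∀ a u v → ((a + u) <ᵇ (a + v)) ≡ (u <ᵇ v)
<ᵇ-shift zero u v = refl
<ᵇ-shift (suc a) u v = <ᵇ-shift a u v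

increasing-shift : ∀ a s → increasing (shift a s) ≡ increasing s
increasing-shift a [] = refl
increasing-shift a (x ∷ []) = refl
increasing-shift a (x ∷ y ∷ s) = cong₂ _∧_ (<ᵇ-shift a x y) (increasing-shift a (y ∷ s))

increasing-++⁻ : ∀ s₁ s₂ → T (increasing (s₁ ++ s₂)) → T (increasing s₁) × T (increasing s₂)
increasing-++⁻ [] s₂ t = tt , t
increasing-++⁻ (x ∷ []) s₂ t = tt , increasing-tail x s₂ t
increasing-++⁻ (x ∷ y ∷ s₁) s₂ t with increasing-++⁻ (y ∷ s₁) s₂ (T-∧⁻ʳ t)
... | inc₁ , inc₂ = T-∧⁺ (T-∧⁻ˡ t) inc₁ , inc₂

increasing-⊕ : ∀ a s₁ s₂ → T (allBelow a s₁) → T (increasing s₁) → T (increasing s₂) →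
  T (increasing (s₁ ++ shift a s₂))
increasing-⊕ a [] s₂ _ _ inc₂ = subst T (sym (increasing-shift a s₂)) inc₂
increasing-⊕ a (x ∷ []) [] _ _ _ = tt
increasing-⊕ a (x ∷ []) (v ∷ s₂) x<a _ inc₂ =
  T-∧⁺ (<⇒<ᵇ (≤-trans (<ᵇ⇒< x a (T-∧⁻ˡ x<a)) (m≤m+n a v))) (subst T (sym (increasing-shift a (v ∷ s₂))) inc₂)
increasing-⊕ a (x ∷ y ∷ s₁) s₂ x<a inc₁ inc₂ =
  T-∧⁺ (T-∧⁻ˡ inc₁) (increasing-⊕ a (y ∷ s₁) s₂ (T-∧⁻ʳ {x <ᵇ a} x<a) (T-∧⁻ʳ inc₁) inc₂)

⊆-++⁻ : ∀ {s} x z → s ⊆ x ++ z → Σ (List ℕ) λ s₁ → Σ (List ℕ) λ s₂ → s ≡ s₁ ++ s₂ × s₁ ⊆ x × s₂ ⊆ z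
⊆-++⁻ [] z s⊆ = [] , _ , refl , [] , s⊆
⊆-++⁻ (e ∷ x) z (refl ∷ s⊆) with ⊆-++⁻ x z s⊆
... | s₁ , s₂ , refl , s₁⊆ , s₂⊆ = e ∷ s₁ , s₂ , refl , refl ∷ s₁⊆ , s₂⊆
⊆-++⁻ (e ∷ x) z (.e ∷ʳ s⊆) with ⊆-++⁻ x z s⊆
... | s₁ , s₂ , refl , s₁⊆ , s₂⊆ = s₁ , s₂ , refl , e ∷ʳ s₁⊆ , s₂⊆

⊆-shift⁻ : ∀ {s} a y → s ⊆ shift a y → Σ (List ℕ) λ s′ → s ≡ shift a s′ × s′ ⊆ y
⊆-shift⁻ a [] [] = [] , refl , []
⊆-shift⁻ a (v ∷ y) (refl ∷ s⊆) with ⊆-shift⁻ a y s⊆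
... | s′ , refl , s′⊆ = v ∷ s′ , refl , refl ∷ s′⊆
⊆-shift⁻ a (v ∷ y) (._ ∷ʳ s⊆) with ⊆-shift⁻ a y s⊆
... | s′ , refl , s′⊆ = s′ , refl , v ∷ʳ s′⊆

all-⊆ : ∀ {p : ℕ → Bool} {s x} → s ⊆ x → T (all p x) → T (all p s)
all-⊆ [] _ = tt
all-⊆ (refl ∷ s⊆) t = T-∧⁺ (T-∧⁻ˡ t) (all-⊆ s⊆ (T-∧⁻ʳ t))
all-⊆ {p} (e ∷ʳ s⊆) t = all-⊆ s⊆ (T-∧⁻ʳ {p e} t)

contains-⊕⁺ : ∀ a x y p q → T (allBelow a x) → T (contains p x) → T (contains q y) →
  T (contains (p + q) (x ++ shift a y))
contains-⊕⁺ a x y p q x<a cp cq with contains⇒IncreasingSub p x cp | contains⇒IncreasingSub q y cq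
... | incSub s₁ s₁⊆ len₁ inc₁ | incSub s₂ s₂⊆ len₂ inc₂ =
  IncreasingSub⇒contains (p + q) _ (incSub (s₁ ++ shift a s₂) (++⁺ s₁⊆ (map⁺ (a +_) s₂⊆))
    (trans (length-++ s₁) (cong₂ _+_ len₁ (trans (length-map (a +_) s₂) len₂)))
    (increasing-⊕ a s₁ s₂ (all-⊆ s₁⊆ x<a) inc₁ inc₂))

contains-⊕⁻ : ∀ a x y j → T (contains j (x ++ shift a y)) →
  Σ ℕ λ p → Σ ℕ λ q → p + q ≡ j × T (contains p x) × T (contains q y)
contains-⊕⁻ a x y j t with contains⇒IncreasingSub j _ t
... | incSub s s⊆ len inc with ⊆-++⁻ x (shift a y) s⊆
... | s₁ , s₂ , refl , s₁⊆ , s₂⊆ with ⊆-shift⁻ a y s₂⊆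
... | s′ , refl , s′⊆ with increasing-++⁻ s₁ (shift a s′) inc
... | inc₁ , inc₂ =
  length s₁ , length s′ ,
  trans (cong (length s₁ +_) (sym (length-map (a +_) s′))) (trans (sym (length-++ s₁)) len) ,
  IncreasingSub⇒contains _ x (incSub s₁ s₁⊆ refl inc₁) ,
  IncreasingSub⇒contains _ y (incSub s′ s′⊆ refl (subst T (increasing-shift a s′) inc₂))

-- The length of a longest increasing subsequence, found by searching down
-- from the largest candidate |x|; `largest c N` is the largest m ≤ N with c m
-- (when c 0 holds).

largest : (ℕ → Bool) → ℕ → ℕ
largest c zero = 0
largest c (suc N) = if c (suc N) then suc N else largest c N

largest-satisfies : ∀ (c : ℕ → Bool) N → T (c 0) → T (c (largest c N))
largest-satisfies c zero c0 = c0
largest-satisfies c (suc N) c0 with c (suc N) in eq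
... | true = subst T (sym eq) tt
... | false = largest-satisfies c N c0

largest-maximal : ∀ (c : ℕ → Bool) N m → m ≤ N → T (c m) → m ≤ largest c N
largest-maximal c zero m m≤0 _ = m≤0
largest-maximal c (suc N) m m≤1+N cm with c (suc N) in eq
... | true = m≤1+N
... | false with m≤n⇒m<n∨m≡n m≤1+N
...   | inj₁ m<1+N = largest-maximal c N m (≤-pred m<1+N) cm
...   | inj₂ refl = ⊥-elim (subst T eq cm)

lis : List ℕ → ℕ
lis x = largest (λ j → contains j x) (length x)

lis-contains : ∀ x → T (contains (lis x) x)
lis-contains x = largest-satisfies (λ j → contains j x) (length x) (contains-0 x)

contains⇒≤lis : ∀ x m → T (contains m x) → m ≤ lis x
contains⇒≤lis x m cm = largest-maximal (λ j → contains j x) (length x) m (contains⇒≤length m x cm) cm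

≤lis⇒contains : ∀ x m → m ≤ lis x → T (contains m x)
≤lis⇒contains x m m≤lis = contains-≤ m (lis x) x m≤lis (lis-contains x)

lis-≥1 : ∀ x → 1 ≤ length x → 1 ≤ lis x
lis-≥1 x 1≤|x| = contains⇒≤lis x 1 (contains-1 x 1≤|x|)

avoids-lis : ∀ j x → avoids j x ≡ (lis x <ᵇ j)
avoids-lis j x = Bool-ext
  (λ av → <⇒<ᵇ (≰⇒> (λ j≤lis → T-not⁻ av (≤lis⇒contains x j j≤lis))))
  (λ lis<j → T-not⁺ (λ cj → <⇒≱ (<ᵇ⇒< (lis x) j lis<j) (contains⇒≤lis x j cj)))

lis-⊕ : ∀ a x y → T (allBelow a x) → lis (x ++ shift a y) ≡ lis x + lis y
lis-⊕ a x y x<a = ≤-antisym split join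
  where
  w = x ++ shift a y
  split : lis w ≤ lis x + lis y
  split with contains-⊕⁻ a x y (lis w) (lis-contains w)
  ... | p , q , p+q≡ , cp , cq = subst (_≤ lis x + lis y) p+q≡ (+-mono-≤ (contains⇒≤lis x p cp) (contains⇒≤lis y q cq))
  join : lis x + lis y ≤ lis w
  join = contains⇒≤lis w _ (contains-⊕⁺ a x y _ _ x<a (lis-contains x) (lis-contains y))

-- Arithmetic behind the sum over m in the corollary: for L, M ≥ 1,
-- L + M < k iff, for the unique m = L in [1, k−2], M < k − m.
lis-window : ∀ k L M → 2 ≤ k → 1 ≤ L → 1 ≤ M →
  𝟙 (L + M <ᵇ k) ≡ ∑₁ (k ∸ 2) (λ m → 𝟙 (m ≡ᵇ L) * 𝟙 (M <ᵇ k ∸ m))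
lis-window k L M 2≤k 1≤L 1≤M with L ≤? k ∸ 2
... | yes L≤k-2 = trans (cong 𝟙 (Bool-ext to from)) (sym (∑₁-pick (k ∸ 2) L (λ m → 𝟙 (M <ᵇ k ∸ m)) 1≤L L≤k-2))
  where
  k≡ : L + (k ∸ L) ≡ k
  k≡ = m+[n∸m]≡n (≤-trans L≤k-2 (m∸n≤m k 2))
  to : T (L + M <ᵇ k) → T (M <ᵇ k ∸ L)
  to t = <⇒<ᵇ (+-cancelˡ-< L M (k ∸ L) (subst (L + M <_) (sym k≡) (<ᵇ⇒< _ k t)))
  from : T (M <ᵇ k ∸ L) → T (L + M <ᵇ k)
  from t = <⇒<ᵇ (subst (L + M <_) k≡ (+-monoʳ-< L (<ᵇ⇒< M _ t)))
... | no L≰k-2 = trans (cong 𝟙 (<ᵇ-false (λ L+M<k → <⇒≱ L+M<k (subst (_≤ L + M) (k-2+2 2≤k) (+-mono-≤ (≰⇒> L≰k-2) 1≤M)))))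
                       (sym (∑₁-pick-none (k ∸ 2) L _ (≰⇒> L≰k-2)))
  where
  k-2+2 : ∀ {k} → 2 ≤ k → suc (k ∸ 2) + 1 ≡ k
  k-2+2 {suc (suc k)} _ = cong suc (+-comm k 1)
  k-2+2 {suc zero} (s≤s ())

avoids-⊕ : ∀ k a x y → 2 ≤ k → T (allBelow a x) → 1 ≤ length x → 1 ≤ length y →
  𝟙 (avoids k (x ++ shift a y)) ≡ ∑₁ (k ∸ 2) (λ m → 𝟙 (m ≡ᵇ lis x) * 𝟙 (avoids (k ∸ m) y))
avoids-⊕ k a x y 2≤k x<a 1≤|x| 1≤|y| = begin
    𝟙 (avoids k (x ++ shift a y))                               ≡⟨ cong 𝟙 (trans (avoids-lis k (x ++ shift a y)) (cong (_<ᵇ k) (lis-⊕ a x y x<a))) ⟩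
    𝟙 (lis x + lis y <ᵇ k)                                      ≡⟨ lis-window k (lis x) (lis y) 2≤k (lis-≥1 x 1≤|x|) (lis-≥1 y 1≤|y|) ⟩
    ∑₁ (k ∸ 2) (λ m → 𝟙 (m ≡ᵇ lis x) * 𝟙 (lis y <ᵇ k ∸ m))     ≡⟨ ∑₁-cong (k ∸ 2) (λ m _ _ → cong (λ b → 𝟙 (m ≡ᵇ lis x) * 𝟙 b) (sym (avoids-lis (k ∸ m) y))) ⟩
    ∑₁ (k ∸ 2) (λ m → 𝟙 (m ≡ᵇ lis x) * 𝟙 (avoids (k ∸ m) y))   ∎
  where open ≡-Reasoning

𝟙-<-suc : ∀ L m → 𝟙 (L <ᵇ suc m) ≡ 𝟙 (L <ᵇ m) + 𝟙 (m ≡ᵇ L)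
𝟙-<-suc zero zero = refl
𝟙-<-suc zero (suc m) = refl
𝟙-<-suc (suc L) zero = refl
𝟙-<-suc (suc L) (suc m) = 𝟙-<-suc L m

avoids-suc : ∀ m x → 𝟙 (avoids (suc m) x) ≡ 𝟙 (avoids m x) + 𝟙 (m ≡ᵇ lis x)
avoids-suc m x = trans (cong 𝟙 (avoids-lis (suc m) x))
  (trans (𝟙-<-suc (lis x) m) (cong (_+ 𝟙 (m ≡ᵇ lis x)) (cong 𝟙 (sym (avoids-lis m x)))))

des-shift : ∀ a y → des (shift a y) ≡ des y
des-shift a [] = refl
des-shift a (x ∷ []) = refl
des-shift a (x ∷ y ∷ s) = cong₂ _+_ (cong (λ b → if b then 1 else 0) (<ᵇ-shift a y x)) (des-shift a (y ∷ s))

des-⊕ : ∀ a e x y → T (allBelow a (e ∷ x)) → des ((e ∷ x) ++ shift a y) ≡ des (e ∷ x) + des y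
des-⊕ a e [] [] _ = refl
des-⊕ a e [] (v ∷ y) e<a = trans (cong (λ b → (if b then 1 else 0) + des (shift a (v ∷ y))) (<ᵇ-false no-descent)) (des-shift a (v ∷ y))
  where
  no-descent : a + v < e → ⊥
  no-descent a+v<e = <⇒≱ (<-trans a+v<e (<ᵇ⇒< e a (T-∧⁻ˡ e<a))) (m≤m+n a v)
des-⊕ a e (f ∷ x) y e<a = trans (cong (d +_) (des-⊕ a f x y (T-∧⁻ʳ {e <ᵇ a} e<a))) (sym (+-assoc d _ _))
  where d = if f <ᵇ e then 1 else 0

𝟙-+-split : ∀ t d i → 𝟙 (t + d ≡ᵇ i) ≡ ∑ (λ c → 𝟙 (t ≡ᵇ c) * 𝟙 (d ≡ᵇ i ∸ c)) (upTo (suc i))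
𝟙-+-split t d i with t ≤? i
... | yes t≤i = trans (cong 𝟙 (Bool-ext to from)) (sym (∑-upTo-pick t (suc i) _ (s≤s t≤i)))
  where
  to : T (t + d ≡ᵇ i) → T (d ≡ᵇ i ∸ t)
  to e = ≡⇒≡ᵇ d (i ∸ t) (trans (sym (m+n∸m≡n t d)) (cong (_∸ t) (≡ᵇ⇒≡ _ i e)))
  from : T (d ≡ᵇ i ∸ t) → T (t + d ≡ᵇ i)
  from e = ≡⇒≡ᵇ (t + d) i (trans (cong (t +_) (≡ᵇ⇒≡ d _ e)) (m+[n∸m]≡n t≤i))
... | no t≰i = trans (cong 𝟙 (≡ᵇ-false (λ t+d≡i → t≰i (≤-trans (m≤m+n t d) (≤-reflexive t+d≡i)))))
                     (sym (∑-upTo-pick-none t (suc i) _ (≰⇒> t≰i)))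

∑-separate : {X Y Z : Set} (f : Z → X → ℕ) (g : Z → Y → ℕ) (xs : List X) (ys : List Y) (zs : List Z) →
  ∑ (λ x → ∑ (λ y → ∑ (λ z → f z x * g z y) zs) ys) xs ≡ ∑ (λ z → ∑ (f z) xs * ∑ (g z) ys) zs
∑-separate f g xs ys zs = begin
    ∑ (λ x → ∑ (λ y → ∑ (λ z → f z x * g z y) zs) ys) xs
  ≡⟨ ∑-cong xs (λ x → ∑-swap (λ y z → f z x * g z y) ys zs) ⟩
    ∑ (λ x → ∑ (λ z → ∑ (λ y → f z x * g z y) ys) zs) xs
  ≡⟨ ∑-swap (λ x z → ∑ (λ y → f z x * g z y) ys) xs zs ⟩
    ∑ (λ z → ∑ (λ x → ∑ (λ y → f z x * g z y) ys) xs) zs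
  ≡⟨ ∑-cong zs (λ z → trans (∑-cong xs (λ x → ∑-*ˡ (f z x) (g z) ys)) (∑-*ʳ (∑ (g z) ys) (f z) xs)) ⟩
    ∑ (λ z → ∑ (f z) xs * ∑ (g z) ys) zs ∎
  where open ≡-Reasoning

-- The numbers J^m_{a,c} of indecomposable permutations of [a] with lis
-- exactly m and c descents; they are the coefficients of I^{12⋯(m+1)} − I^{12⋯m}.
exactLis : ℕ → ℕ → ℕ → ℕ
exactLis m a c = ∑ (λ x → 𝟙 (distinct x) * (𝟙 (indecomposable x) * (𝟙 (m ≡ᵇ lis x) * 𝟙 (des x ≡ᵇ c)))) (words a a)

Icount-suc : ∀ m a c → Icount (suc m) a c ≡ Icount m a c + exactLis m a c
Icount-suc m a c = begin
    Icount (suc m) a c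
  ≡⟨ count-perms _ a ⟩
    ∑ (λ x → 𝟙 (distinct x) * 𝟙 (avoids (suc m) x ∧ indecomposable x ∧ (des x ≡ᵇ c))) (words a a)
  ≡⟨ ∑-cong (words a a) split ⟩
    ∑ (λ x → 𝟙 (distinct x) * 𝟙 (avoids m x ∧ indecomposable x ∧ (des x ≡ᵇ c)) + J x) (words a a)
  ≡⟨ ∑-+ _ J (words a a) ⟩
    ∑ (λ x → 𝟙 (distinct x) * 𝟙 (avoids m x ∧ indecomposable x ∧ (des x ≡ᵇ c))) (words a a) + exactLis m a c
  ≡⟨ cong (_+ exactLis m a c) (sym (count-perms _ a)) ⟩
    Icount m a c + exactLis m a c ∎
  where
  open ≡-Reasoning
  J : List ℕ → ℕ
  J x = 𝟙 (distinct x) * (𝟙 (indecomposable x) * (𝟙 (m ≡ᵇ lis x) * 𝟙 (des x ≡ᵇ c)))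
  distribute : ∀ d p q r t → d * ((p + q) * (r * t)) ≡ d * (p * (r * t)) + d * (r * (q * t))
  distribute = solve-∀
  split : ∀ x → 𝟙 (distinct x) * 𝟙 (avoids (suc m) x ∧ indecomposable x ∧ (des x ≡ᵇ c))
              ≡ 𝟙 (distinct x) * 𝟙 (avoids m x ∧ indecomposable x ∧ (des x ≡ᵇ c)) + J x
  split x = begin
      𝟙 (distinct x) * 𝟙 (avoids (suc m) x ∧ indecomposable x ∧ (des x ≡ᵇ c))
    ≡⟨ cong (𝟙 (distinct x) *_) (trans (𝟙-∧ (avoids (suc m) x) _) (cong₂ _*_ (avoids-suc m x) (𝟙-∧ (indecomposable x) _))) ⟩
      𝟙 (distinct x) * ((𝟙 (avoids m x) + 𝟙 (m ≡ᵇ lis x)) * (𝟙 (indecomposable x) * 𝟙 (des x ≡ᵇ c)))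
    ≡⟨ distribute (𝟙 (distinct x)) (𝟙 (avoids m x)) (𝟙 (m ≡ᵇ lis x)) (𝟙 (indecomposable x)) (𝟙 (des x ≡ᵇ c)) ⟩
      𝟙 (distinct x) * (𝟙 (avoids m x) * (𝟙 (indecomposable x) * 𝟙 (des x ≡ᵇ c))) + J x
    ≡⟨ cong (λ z → 𝟙 (distinct x) * z + J x) (sym (trans (𝟙-∧ (avoids m x) _) (cong (𝟙 (avoids m x) *_) (𝟙-∧ (indecomposable x) _)))) ⟩
      𝟙 (distinct x) * 𝟙 (avoids m x ∧ indecomposable x ∧ (des x ≡ᵇ c)) + J x ∎

avoidDes : ℕ → ℕ → List ℕ → ℕ
avoidDes k i w = 𝟙 (avoids k w) * 𝟙 (des w ≡ᵇ i)

blockCount : ℕ → ℕ → ℕ → ℕ → ℕ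
blockCount k i n a = ∑ (λ w → 𝟙 (distinct w ∧ (iπ w ≡ᵇ a)) * avoidDes k i w) (words n n)

-- Every permutation of [n], n ≥ 1, has its first block of a unique length in [1, n].
Acount-byBlock : ∀ k i n → 1 ≤ n → Acount k n i ≡ ∑₁ n (blockCount k i n)
Acount-byBlock k i n 1≤n = begin
    Acount k n i
  ≡⟨ count-perms _ n ⟩
    ∑ (λ w → 𝟙 (distinct w) * 𝟙 (avoids k w ∧ (des w ≡ᵇ i))) (words n n)
  ≡⟨ ∑-words-cong n n (λ w |w|≡n _ → sym (unique-block w |w|≡n)) ⟩
    ∑ (λ w → ∑₁ n (λ a → 𝟙 (distinct w ∧ (iπ w ≡ᵇ a)) * avoidDes k i w)) (words n n)
  ≡⟨ ∑-∑₁ n _ (words n n) ⟩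
    ∑₁ n (blockCount k i n) ∎
  where
  open ≡-Reasoning
  reorder : ∀ d e f → d * e * f ≡ e * (d * f)
  reorder = solve-∀
  unique-block : ∀ w → length w ≡ n →
    ∑₁ n (λ a → 𝟙 (distinct w ∧ (iπ w ≡ᵇ a)) * avoidDes k i w) ≡ 𝟙 (distinct w) * 𝟙 (avoids k w ∧ (des w ≡ᵇ i))
  unique-block w |w|≡n = begin
      ∑₁ n (λ a → 𝟙 (distinct w ∧ (iπ w ≡ᵇ a)) * avoidDes k i w)
    ≡⟨ ∑₁-cong n (λ a _ _ → trans (cong (_* avoidDes k i w) (trans (𝟙-∧ (distinct w) _) (cong (λ b → 𝟙 (distinct w) * 𝟙 b) (≡ᵇ-sym (iπ w) a))))
                                  (reorder (𝟙 (distinct w)) _ (avoidDes k i w))) ⟩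
      ∑₁ n (λ a → 𝟙 (a ≡ᵇ iπ w) * (𝟙 (distinct w) * avoidDes k i w))
    ≡⟨ ∑₁-pick n (iπ w) _ (iπ-≥1 w) (subst (iπ w ≤_) |w|≡n (iπ-≤ w (subst (1 ≤_) (sym |w|≡n) 1≤n))) ⟩
      𝟙 (distinct w) * avoidDes k i w
    ≡⟨ cong (𝟙 (distinct w) *_) (sym (𝟙-∧ (avoids k w) _)) ⟩
      𝟙 (distinct w) * 𝟙 (avoids k w ∧ (des w ≡ᵇ i)) ∎

blockCount-full : ∀ k i n → 1 ≤ n → blockCount k i n n ≡ Icount k n i
blockCount-full k i n 1≤n = begin
    blockCount k i n n
  ≡⟨ ∑-words-cong n n (λ w |w|≡n _ → pointwise w |w|≡n) ⟩
    ∑ (λ w → 𝟙 (distinct w) * 𝟙 (avoids k w ∧ indecomposable w ∧ (des w ≡ᵇ i))) (words n n)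
  ≡⟨ sym (count-perms _ n) ⟩
    Icount k n i ∎
  where
  open ≡-Reasoning
  reorder : ∀ d e a b → d * e * (a * b) ≡ d * (a * (e * b))
  reorder = solve-∀
  pointwise : ∀ w → length w ≡ n →
    𝟙 (distinct w ∧ (iπ w ≡ᵇ n)) * avoidDes k i w ≡ 𝟙 (distinct w) * 𝟙 (avoids k w ∧ indecomposable w ∧ (des w ≡ᵇ i))
  pointwise w |w|≡n = begin
      𝟙 (distinct w ∧ (iπ w ≡ᵇ n)) * avoidDes k i w
    ≡⟨ cong (_* avoidDes k i w) (trans (𝟙-∧ (distinct w) _) (cong (λ b → 𝟙 (distinct w) * 𝟙 b) (sym (indecomposable-iπ w n |w|≡n 1≤n)))) ⟩
      𝟙 (distinct w) * 𝟙 (indecomposable w) * (𝟙 (avoids k w) * 𝟙 (des w ≡ᵇ i))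
    ≡⟨ reorder (𝟙 (distinct w)) (𝟙 (indecomposable w)) (𝟙 (avoids k w)) (𝟙 (des w ≡ᵇ i)) ⟩
      𝟙 (distinct w) * (𝟙 (avoids k w) * (𝟙 (indecomposable w) * 𝟙 (des w ≡ᵇ i)))
    ≡⟨ cong (𝟙 (distinct w) *_) (sym (trans (𝟙-∧ (avoids k w) _) (cong (𝟙 (avoids k w) *_) (𝟙-∧ (indecomposable w) _)))) ⟩
      𝟙 (distinct w) * 𝟙 (avoids k w ∧ indecomposable w ∧ (des w ≡ᵇ i)) ∎

𝟙-∧₄ : ∀ p q r s (F : ℕ) → 𝟙 ((p ∧ q) ∧ (r ∧ s)) * F ≡ 𝟙 p * (𝟙 q * (𝟙 r * (𝟙 s * F)))
𝟙-∧₄ p q r s F = trans (cong (_* F) (trans (𝟙-∧ (p ∧ q) _) (cong₂ _*_ (𝟙-∧ p q) (𝟙-∧ r s))))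
                       (reassociate (𝟙 p) (𝟙 q) (𝟙 r) (𝟙 s) F)
  where
  reassociate : ∀ p q r s t → p * q * (r * s) * t ≡ p * (q * (r * (s * t)))
  reassociate = solve-∀

-- A permutation of [a + b] with first block of length a < a + b is
-- x ++ shift a y for an indecomposable permutation x of [a] and a permutation y of [b].
blockCount-⊕ : ∀ k i a b → 1 ≤ a →
  blockCount k i (a + b) a
    ≡ ∑ (λ x → 𝟙 (distinct x ∧ (iπ x ≡ᵇ a)) * ∑ (λ y → 𝟙 (distinct y) * avoidDes k i (x ++ shift a y)) (words b b)) (words a a)
blockCount-⊕ k i a b 1≤a = begin
    blockCount k i (a + b) a
  ≡⟨ ∑-words-++ f (a + b) a b ⟩
    ∑ (λ x → ∑ (λ y → f (x ++ y)) (words (a + b) b)) (words (a + b) a)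
  ≡⟨ ∑-words-cong (a + b) a second-half ⟩
    ∑ (λ x → 𝟙 (allBelow a x) * H x) (words (a + b) a)
  ≡⟨ ∑-words-below a b a H ⟩
    ∑ H (words a a) ∎
  where
  open ≡-Reasoning
  f : List ℕ → ℕ
  f w = 𝟙 (distinct w ∧ (iπ w ≡ᵇ a)) * avoidDes k i w
  G : List ℕ → List ℕ → ℕ
  G x y = 𝟙 (distinct y) * avoidDes k i (x ++ y)
  H : List ℕ → ℕ
  H x = 𝟙 (distinct x ∧ (iπ x ≡ᵇ a)) * ∑ (λ y → 𝟙 (distinct y) * avoidDes k i (x ++ shift a y)) (words b b)
  second-half : ∀ x → length x ≡ a → T (allBelow (a + b) x) →
    ∑ (λ y → f (x ++ y)) (words (a + b) b) ≡ 𝟙 (allBelow a x) * H x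
  second-half x |x|≡a x<a+b = begin
      ∑ (λ y → f (x ++ y)) (words (a + b) b)
    ≡⟨ ∑-words-cong (a + b) b (λ y |y|≡b _ → trans
         (cong (λ z → 𝟙 z * avoidDes k i (x ++ y)) (firstBlock-split x y a |x|≡a 1≤a (subst (λ n → T (allBelow (a + n) x)) (sym |y|≡b) x<a+b)))
         (𝟙-∧₄ (allBelow a x) _ (allAtLeast a y) _ _)) ⟩
      ∑ (λ y → 𝟙 (allBelow a x) * (𝟙 X * (𝟙 (allAtLeast a y) * G x y))) (words (a + b) b)
    ≡⟨ trans (∑-*ˡ (𝟙 (allBelow a x)) _ (words (a + b) b)) (cong (𝟙 (allBelow a x) *_) (∑-*ˡ (𝟙 X) _ (words (a + b) b))) ⟩
      𝟙 (allBelow a x) * (𝟙 X * ∑ (λ y → 𝟙 (allAtLeast a y) * G x y) (words (a + b) b))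
    ≡⟨ cong (λ z → 𝟙 (allBelow a x) * (𝟙 X * z)) (∑-words-above a b b (G x)) ⟩
      𝟙 (allBelow a x) * (𝟙 X * ∑ (λ y → G x (shift a y)) (words b b))
    ≡⟨ cong (λ z → 𝟙 (allBelow a x) * (𝟙 X * z))
         (∑-cong (words b b) (λ y → cong (λ d → 𝟙 d * avoidDes k i (x ++ shift a y)) (distinct-shift a y))) ⟩
      𝟙 (allBelow a x) * H x ∎
    where X = distinct x ∧ (iπ x ≡ᵇ a)

⊕-expansion : ∀ k i a x y (P Q : ℕ) → 2 ≤ k → T (allBelow a x) → 1 ≤ length x → 1 ≤ length y →
  P * (Q * avoidDes k i (x ++ shift a y))
    ≡ ∑₁ (k ∸ 2) (λ m → ∑ (λ c → (P * (𝟙 (m ≡ᵇ lis x) * 𝟙 (des x ≡ᵇ c))) * (Q * avoidDes (k ∸ m) (i ∸ c) y)) (upTo (suc i)))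
⊕-expansion k i a x@(e ∷ x′) y P Q 2≤k x<a 1≤|x| 1≤|y| = begin
    P * (Q * (𝟙 (avoids k w) * 𝟙 (des w ≡ᵇ i)))
  ≡⟨ trans (sym (*-assoc P Q _)) (cong (P * Q *_) (cong₂ _*_ (avoids-⊕ k a x y 2≤k x<a 1≤|x| 1≤|y|) des-split)) ⟩
    P * Q * (∑₁ M (λ m → 𝟙 (m ≡ᵇ lis x) * 𝟙 (avoids (k ∸ m) y)) * ∑ (λ c → 𝟙 (des x ≡ᵇ c) * 𝟙 (des y ≡ᵇ i ∸ c)) Lc)
  ≡⟨ ∑₁-∑-distrib M Lc (P * Q) (λ m → 𝟙 (m ≡ᵇ lis x) * 𝟙 (avoids (k ∸ m) y)) (λ c → 𝟙 (des x ≡ᵇ c) * 𝟙 (des y ≡ᵇ i ∸ c)) ⟩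
    ∑₁ M (λ m → ∑ (λ c → P * Q * (𝟙 (m ≡ᵇ lis x) * 𝟙 (avoids (k ∸ m) y) * (𝟙 (des x ≡ᵇ c) * 𝟙 (des y ≡ᵇ i ∸ c)))) Lc)
  ≡⟨ ∑₁-cong M (λ m _ _ → ∑-cong Lc (λ c → regroup P Q (𝟙 (m ≡ᵇ lis x)) (𝟙 (avoids (k ∸ m) y)) (𝟙 (des x ≡ᵇ c)) (𝟙 (des y ≡ᵇ i ∸ c)))) ⟩
    ∑₁ M (λ m → ∑ (λ c → (P * (𝟙 (m ≡ᵇ lis x) * 𝟙 (des x ≡ᵇ c))) * (Q * avoidDes (k ∸ m) (i ∸ c) y)) Lc) ∎
  where
  open ≡-Reasoning
  M = k ∸ 2
  Lc = upTo (suc i)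
  w = x ++ shift a y
  des-split : 𝟙 (des w ≡ᵇ i) ≡ ∑ (λ c → 𝟙 (des x ≡ᵇ c) * 𝟙 (des y ≡ᵇ i ∸ c)) Lc
  des-split = trans (cong (λ t → 𝟙 (t ≡ᵇ i)) (des-⊕ a e x′ y x<a)) (𝟙-+-split (des x) (des y) i)
  regroup : ∀ P Q α γ δ ε → P * Q * (α * γ * (δ * ε)) ≡ (P * (α * δ)) * (Q * (γ * ε))
  regroup = solve-∀

blockCount-proper : ∀ k i a b → 2 ≤ k → 1 ≤ a → 1 ≤ b →
  blockCount k i (a + b) a ≡ ∑₁ (k ∸ 2) (λ m → ∑ (λ c → exactLis m a c * Acount (k ∸ m) b (i ∸ c)) (upTo (suc i)))
blockCount-proper k i a b 2≤k 1≤a 1≤b = begin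
    blockCount k i (a + b) a
  ≡⟨ blockCount-⊕ k i a b 1≤a ⟩
    ∑ (λ x → 𝟙 (indec x) * ∑ (λ y → 𝟙 (distinct y) * avoidDes k i (x ++ shift a y)) (words b b)) (words a a)
  ≡⟨ ∑-cong (words a a) (λ x → sym (∑-*ˡ (𝟙 (indec x)) _ (words b b))) ⟩
    ∑ (λ x → ∑ (λ y → 𝟙 (indec x) * (𝟙 (distinct y) * avoidDes k i (x ++ shift a y))) (words b b)) (words a a)
  ≡⟨ ∑-words-cong a a (λ x |x|≡a x<a → ∑-words-cong b b (λ y |y|≡b _ →
       ⊕-expansion k i a x y (𝟙 (indec x)) (𝟙 (distinct y)) 2≤k x<a (nonempty x |x|≡a 1≤a) (nonempty y |y|≡b 1≤b))) ⟩
    ∑ (λ x → ∑ (λ y → ∑₁ M (λ m → ∑ (λ c → U m c x * V m c y) Lc)) (words b b)) (words a a)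
  ≡⟨ trans (∑-cong (words a a) (λ x → ∑-∑₁ M _ (words b b))) (∑-∑₁ M _ (words a a)) ⟩
    ∑₁ M (λ m → ∑ (λ x → ∑ (λ y → ∑ (λ c → U m c x * V m c y) Lc) (words b b)) (words a a))
  ≡⟨ ∑₁-cong M (λ m _ _ → trans (∑-separate (U m) (V m) (words a a) (words b b) Lc)
                                (∑-cong Lc (λ c → cong₂ _*_ (∑U m c) (∑V m c)))) ⟩
    ∑₁ M (λ m → ∑ (λ c → exactLis m a c * Acount (k ∸ m) b (i ∸ c)) Lc) ∎
  where
  open ≡-Reasoning
  M = k ∸ 2
  Lc = upTo (suc i)
  indec : List ℕ → Bool
  indec x = distinct x ∧ (iπ x ≡ᵇ a)
  U : ℕ → ℕ → List ℕ → ℕ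
  U m c x = 𝟙 (indec x) * (𝟙 (m ≡ᵇ lis x) * 𝟙 (des x ≡ᵇ c))
  V : ℕ → ℕ → List ℕ → ℕ
  V m c y = 𝟙 (distinct y) * avoidDes (k ∸ m) (i ∸ c) y
  nonempty : ∀ w {n} → length w ≡ n → 1 ≤ n → 1 ≤ length w
  nonempty w |w|≡n 1≤n = subst (1 ≤_) (sym |w|≡n) 1≤n
  ∑U : ∀ m c → ∑ (U m c) (words a a) ≡ exactLis m a c
  ∑U m c = ∑-words-cong a a (λ x |x|≡a _ → trans (cong (_* _) (𝟙-∧ (distinct x) _))
             (trans (*-assoc (𝟙 (distinct x)) _ _)
               (cong (λ z → 𝟙 (distinct x) * (𝟙 z * (𝟙 (m ≡ᵇ lis x) * 𝟙 (des x ≡ᵇ c)))) (sym (indecomposable-iπ x a |x|≡a 1≤a)))))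
  ∑V : ∀ m c → ∑ (V m c) (words b b) ≡ Acount (k ∸ m) b (i ∸ c)
  ∑V m c = trans (∑-cong (words b b) (λ y → cong (𝟙 (distinct y) *_) (sym (𝟙-∧ (avoids (k ∸ m) y) _))))
                 (sym (count-perms _ b))

-- Coefficients of A^{12⋯j} − 1, whose constant term vanishes.
Apos : ℕ → ℕ → ℕ → ℕ
Apos j zero d = 0
Apos j (suc b) d = Acount j (suc b) d

-- The coefficient of x^n q^i in Σ_{m=1}^{k−2} (I^{12⋯(m+1)} − I^{12⋯m})(A^{12⋯(k−m)} − 1).
convolution : ℕ → ℕ → ℕ → ℕ
convolution k n i = ∑₁ (k ∸ 2) (λ m → ∑ (λ a → ∑ (λ c → exactLis m a c * Apos (k ∸ m) (n ∸ a) (i ∸ c)) (upTo (suc i))) (upTo (suc n)))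

contribution : ℕ → ℕ → ℕ → ℕ → ℕ
contribution k n i a = ∑₁ (k ∸ 2) (λ m → ∑ (λ c → exactLis m a c * Apos (k ∸ m) (n ∸ a) (i ∸ c)) (upTo (suc i)))

-- Only the indices 1 ≤ a ≤ n − 1 contribute: there are no blocks of length 0,
-- and a block of length n leaves nothing for the second summand.
convolution-byBlock : ∀ k n′ i → convolution k (suc n′) i ≡ ∑₁ n′ (contribution k (suc n′) i)
convolution-byBlock k n′ i = begin
    convolution k n i             ≡⟨ sym (∑-∑₁ (k ∸ 2) _ (upTo (suc n))) ⟩
    ∑ W (upTo (suc n))            ≡⟨ ∑-upTo≡head+∑₁ n W ⟩
    W 0 + (∑₁ n′ W + W n)         ≡⟨ cong₂ (λ p q → p + (∑₁ n′ W + q)) W0 Wn ⟩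
    ∑₁ n′ W + 0                   ≡⟨ +-identityʳ _ ⟩
    ∑₁ n′ W                       ∎
  where
  open ≡-Reasoning
  n = suc n′
  Lc = upTo (suc i)
  W = contribution k n i
  W0 : W 0 ≡ 0
  W0 = trans (∑₁-cong (k ∸ 2) (λ m _ _ → ∑-zero Lc)) (∑₁-zero (k ∸ 2))
  Wn : W n ≡ 0
  Wn = trans (∑₁-cong (k ∸ 2) (λ m _ _ → ∑-upTo-vanish (suc i) (λ c _ →
         trans (cong (λ z → exactLis m n c * Apos (k ∸ m) z (i ∸ c)) (n∸n≡0 n)) (*-zeroʳ (exactLis m n c)))))
       (∑₁-zero (k ∸ 2))

convolution-0 : ∀ k i → convolution k 0 i ≡ 0
convolution-0 k i = trans (∑₁-cong (k ∸ 2) (λ m _ _ → cong (_+ 0) (∑-zero (upTo (suc i))))) (∑₁-zero (k ∸ 2))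

blockCount≡contribution : ∀ k i n a → 2 ≤ k → 1 ≤ a → a < n → blockCount k i n a ≡ contribution k n i a
blockCount≡contribution k i n a 2≤k 1≤a a<n = begin
    blockCount k i n a
  ≡⟨ cong (λ z → blockCount k i z a) (sym (m+[n∸m]≡n (<⇒≤ a<n))) ⟩
    blockCount k i (a + (n ∸ a)) a
  ≡⟨ blockCount-proper k i a (n ∸ a) 2≤k 1≤a 1≤n-a ⟩
    ∑₁ (k ∸ 2) (λ m → ∑ (λ c → exactLis m a c * Acount (k ∸ m) (n ∸ a) (i ∸ c)) (upTo (suc i)))
  ≡⟨ ∑₁-cong (k ∸ 2) (λ m _ _ → ∑-cong (upTo (suc i)) (λ c → cong (exactLis m a c *_) (Acount≡Apos (n ∸ a) 1≤n-a))) ⟩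
    contribution k n i a ∎
  where
  open ≡-Reasoning
  1≤n-a : 1 ≤ n ∸ a
  1≤n-a = m<n⇒0<n∸m a<n
  Acount≡Apos : ∀ {j d} b → 1 ≤ b → Acount j b d ≡ Apos j b d
  Acount≡Apos (suc b) _ = refl

Acount-recurrence : ∀ k n i → 2 ≤ k → 1 ≤ n → Acount k n i ≡ Icount k n i + convolution k n i
Acount-recurrence k n@(suc n′) i 2≤k 1≤n = begin
    Acount k n i
  ≡⟨ Acount-byBlock k i n 1≤n ⟩
    ∑₁ n′ (blockCount k i n) + blockCount k i n n
  ≡⟨ cong₂ _+_ (∑₁-cong n′ (λ a 1≤a a≤n′ → blockCount≡contribution k i n a 2≤k 1≤a (s≤s a≤n′)))
               (blockCount-full k i n 1≤n) ⟩
    ∑₁ n′ (contribution k n i) + Icount k n i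
  ≡⟨ +-comm (∑₁ n′ (contribution k n i)) _ ⟩
    Icount k n i + ∑₁ n′ (contribution k n i)
  ≡⟨ cong (Icount k n i +_) (sym (convolution-byBlock k n′ i)) ⟩
    Icount k n i + convolution k n i ∎
  where open ≡-Reasoning

Icount-0 : ∀ j c → Icount j 0 c ≡ 0
Icount-0 j c = trans (count-perms (λ w → avoids j w ∧ indecomposable w ∧ (des w ≡ᵇ c)) 0) (cong (λ b → 1 * 𝟙 b + 0) (∧-zeroʳ (avoids j [])))

I≡Icount : ∀ j a c → I j a c ≡ ⁺ Icount j a c
I≡Icount j zero c = cong ⁺_ (sym (Icount-0 j c))
I≡Icount j (suc a) c = refl

I-difference : ∀ m a c → (I (suc m) ⊖ I m) a c ≡ ⁺ exactLis m a c
I-difference m a c = begin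
    I (suc m) a c -ℤ I m a c
  ≡⟨ cong₂ _-ℤ_ (trans (I≡Icount (suc m) a c) (trans (cong ⁺_ (Icount-suc m a c)) (ℤₚ.pos-+ (Icount m a c) (exactLis m a c))))
                (I≡Icount m a c) ⟩
    (⁺ Icount m a c +ℤ ⁺ exactLis m a c) -ℤ ⁺ Icount m a c
  ≡⟨ cancel (⁺ Icount m a c) (⁺ exactLis m a c) ⟩
    ⁺ exactLis m a c ∎
  where
  open ≡-Reasoning
  cancel : ∀ (p q : ℤ) → (p +ℤ q) -ℤ p ≡ q
  cancel = ℤ-Solver.solve-∀

A-minus-one : ∀ j b d → (A j ⊖ one) b d ≡ ⁺ Apos j b d
A-minus-one j zero d = ℤₚ.+-inverseʳ (one zero d)
A-minus-one j (suc b) d = ℤₚ.+-identityʳ (⁺ Acount j (suc b) d)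

sumTo≡∑ : ∀ n (h : ℕ → ℤ) (h′ : ℕ → ℕ) → (∀ a → h a ≡ ⁺ h′ a) → sumTo n h ≡ ⁺ ∑ h′ (upTo (suc n))
sumTo≡∑ n h h′ h≡ = go (upTo (suc n))
  where
  go : ∀ xs → foldr (λ a acc → h a +ℤ acc) (⁺ 0) xs ≡ ⁺ ∑ h′ xs
  go [] = refl
  go (x ∷ xs) = trans (cong₂ _+ℤ_ (h≡ x) (go xs)) (sym (ℤₚ.pos-+ (h′ x) (∑ h′ xs)))

sumS≡∑₁ : ∀ M (G : ℕ → Series) (g : ℕ → ℕ) n i → (∀ m → G m n i ≡ ⁺ g m) → sumS M G n i ≡ ⁺ ∑₁ M g
sumS≡∑₁ zero G g n i G≡ = refl
sumS≡∑₁ (suc M) G g n i G≡ =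
  trans (cong₂ _+ℤ_ (sumS≡∑₁ M G g n i G≡) (G≡ (suc M))) (sym (ℤₚ.pos-+ (∑₁ M g) (g (suc M))))

convolution-series : ∀ k n i →
  sumS (k ∸ 2) (λ m → (I (suc m) ⊖ I m) ⊗ (A (k ∸ m) ⊖ one)) n i ≡ ⁺ convolution k n i
convolution-series k n i = sumS≡∑₁ (k ∸ 2) _ _ n i (λ m → sumTo≡∑ n _ _ (λ a → sumTo≡∑ i _ _ (λ c →
  trans (cong₂ _*ℤ_ (I-difference m a c) (A-minus-one (k ∸ m) (n ∸ a) (i ∸ c)))
        (sym (ℤₚ.pos-* (exactLis m a c) (Apos (k ∸ m) (n ∸ a) (i ∸ c)))))))

I-recurrence : ∀ k n i → 2 ≤ k → I k n i ≡ (A k n i -ℤ ⁺ convolution k n i) -ℤ one n i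
I-recurrence k zero i _ = begin
    ⁺ 0                                                     ≡⟨ sym (vanish (one zero i)) ⟩
    (one zero i -ℤ ⁺ 0) -ℤ one zero i                       ≡⟨ cong (λ z → (one zero i -ℤ ⁺ z) -ℤ one zero i) (sym (convolution-0 k i)) ⟩
    (one zero i -ℤ ⁺ convolution k 0 i) -ℤ one zero i       ∎
  where
  open ≡-Reasoning
  vanish : ∀ (p : ℤ) → (p -ℤ ⁺ 0) -ℤ p ≡ ⁺ 0
  vanish = ℤ-Solver.solve-∀
I-recurrence k n@(suc _) i 2≤k = begin
    ⁺ Icount k n i                               ≡⟨ sym (cancel (⁺ Icount k n i) (⁺ C)) ⟩
    (⁺ Icount k n i +ℤ ⁺ C -ℤ ⁺ C) -ℤ ⁺ 0         ≡⟨ cong (λ z → (z -ℤ ⁺ C) -ℤ ⁺ 0) (sym (ℤₚ.pos-+ (Icount k n i) C)) ⟩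
    (⁺ (Icount k n i + C) -ℤ ⁺ C) -ℤ ⁺ 0          ≡⟨ cong (λ z → (⁺ z -ℤ ⁺ C) -ℤ ⁺ 0) (sym (Acount-recurrence k n i 2≤k (s≤s z≤n))) ⟩
    (⁺ Acount k n i -ℤ ⁺ C) -ℤ ⁺ 0                ∎
  where
  open ≡-Reasoning
  C = convolution k n i
  cancel : ∀ (p q : ℤ) → (p +ℤ q -ℤ q) -ℤ ⁺ 0 ≡ p
  cancel = ℤ-Solver.solve-∀

corollary3p21 : (k : ℕ) → 3 ≤ k → (n i : ℕ) →
    I k n i ≡ (((A k) ⊖ sumS (k ∸ 2) (λ m → (I (suc m) ⊖ I m) ⊗ (A (k ∸ m) ⊖ one))) ⊖ one) n i
corollary3p21 k 3≤k n i = begin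
    I k n i
  ≡⟨ I-recurrence k n i (≤-trans (n≤1+n 2) 3≤k) ⟩
    (A k n i -ℤ ⁺ convolution k n i) -ℤ one n i
  ≡⟨ cong (λ z → (A k n i -ℤ z) -ℤ one n i) (sym (convolution-series k n i)) ⟩
    (((A k) ⊖ sumS (k ∸ 2) (λ m → (I (suc m) ⊖ I m) ⊗ (A (k ∸ m) ⊖ one))) ⊖ one) n i ∎
  where open ≡-Reasoning
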